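{- Let $m\ge 1$ and let $\tau=m\tau'm\in[m]^l$ be a subword pattern, where the word $\tau'$ (of length $l-2$) does not contain the letter $m$. Then for every $k\ge m$, \[ F_\tau(x,y;k)=\frac{1}{1-(m-1)x-x\sum_{j=m-1}^{k-1}\frac{1}{1+\binom{j}{m-1}x^{l-1}(1-y)}}. \]
   Context: $[k]=\{1,\dots,k\}$ and $[k]^n$ is the set of words of length $n$ over $[k]$. A subword pattern is a word $\tau\in[m]^l$ containing every letter of $[m]$. An occurrence of $\tau$ in $\sigma=\sigma_1\cdots\sigma_n$ is an index $i$ such that the consecutive factor $\sigma_i\cdots\sigma_{i+l-1}$ is order-isomorphic to $\tau$ (same relative order and same equalities among positions). $\sigma(\tau)$ is the number of occurrences, and $F_\tau(x,y;k)=\sum_{n\ge0}\sum_{\sigma\in[k]^n}x^ny^{\sigma(\tau)}$. -}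

module Defs where

open import Data.Nat as ℕ using (ℕ; zero; suc; _∸_; _<ᵇ_; _≡ᵇ_)
open import Data.Nat.Combinatorics using (_C_)
open import Data.Bool using (Bool; true; false; _∧_; if_then_else_)
open import Data.List using (List; []; _∷_; map; concatMap; upTo; take; length; zip; foldr)
open import Data.Product using (_×_; _,_)
open import Data.Integer as ℤ using (ℤ; +_)
open import Relation.Binary.PropositionalEquality using (_≡_)

letters : ℕ → List ℕ
letters k = map suc (upTo k)

words : ℕ → ℕ → List (List ℕ)
words k zero    = [] ∷ []
words k (suc n) = concatMap (λ a → map (a ∷_) (words k n)) (letters k)

_⇔ᵇ_ : Bool → Bool → Bool
true  ⇔ᵇ b = b
false ⇔ᵇ true = false
false ⇔ᵇ false = true

compatible : ℕ × ℕ → ℕ × ℕ → Bool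
compatible (s₁ , t₁) (s₂ , t₂) =
  ((s₁ <ᵇ s₂) ⇔ᵇ (t₁ <ᵇ t₂)) ∧ ((s₁ ≡ᵇ s₂) ⇔ᵇ (t₁ ≡ᵇ t₂))

allB : {A : Set} → (A → Bool) → List A → Bool
allB p [] = true
allB p (x ∷ xs) = p x ∧ allB p xs

orderIso : List ℕ → List ℕ → Bool
orderIso s t = (length s ≡ᵇ length t) ∧ allB (λ p → allB (compatible p) ps) ps
  where ps = zip s t

occurrences : List ℕ → List ℕ → ℕ
occurrences τ [] = 0
occurrences τ (a ∷ σ) =
  (if orderIso τ (take (length τ) (a ∷ σ)) then 1 else 0) ℕ.+ occurrences τ σ

countWith : List ℕ → ℕ → List (List ℕ) → ℕ
countWith τ d [] = 0
countWith τ d (σ ∷ σs) = (if occurrences τ σ ≡ᵇ d then 1 else 0) ℕ.+ countWith τ d σs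

-- Formal power series in x, y over ℤ: coefficient of x^n y^d.

Series : Set
Series = ℕ → ℕ → ℤ

_≈S_ : Series → Series → Set
f ≈S g = ∀ n d → f n d ≡ g n d

sumBelow : ℕ → (ℕ → ℤ) → ℤ
sumBelow zero f = + 0
sumBelow (suc n) f = sumBelow n f ℤ.+ f n

_⊕_ : Series → Series → Series
(f ⊕ g) n d = f n d ℤ.+ g n d

_⊖_ : Series → Series → Series
(f ⊖ g) n d = f n d ℤ.- g n d

_•_ : ℤ → Series → Series
(c • f) n d = c ℤ.* f n d

_⊛_ : Series → Series → Series
(f ⊛ g) n d = sumBelow (suc n) λ i → sumBelow (suc d) λ j →
  f i j ℤ.* g (n ∸ i) (d ∸ j)

zeroS : Series
zeroS n d = + 0

oneS : Series
oneS zero zero = + 1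
oneS _    _    = + 0

X : Series
X (suc zero) zero = + 1
X _ _ = + 0

Y : Series
Y zero (suc zero) = + 1
Y _ _ = + 0

_^S_ : Series → ℕ → Series
f ^S zero = oneS
f ^S suc n = f ⊛ (f ^S n)

sumS : List ℕ → (ℕ → Series) → Series
sumS js E = foldr (λ j acc → E j ⊕ acc) zeroS js

range : ℕ → ℕ → List ℕ
range a b = map (λ i → a ℕ.+ i) (upTo (suc b ∸ a))

F : List ℕ → ℕ → Series
F τ k n d = + countWith τ d (words k n)

Dj : ℕ → ℕ → ℕ → Series
Dj m l j = oneS ⊕ ((+ (j C (m ∸ 1))) • ((X ^S (l ∸ 1)) ⊛ (oneS ⊖ Y)))

denominator : ℕ → ℕ → (ℕ → Series) → Series
denominator m k E = (oneS ⊖ ((+ (m ∸ 1)) • X)) ⊖ (X ⊛ sumS (range (m ∸ 1) (k ∸ 1)) E)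

{-# OPTIONS --safe #-}
module Submission where

-- Write A_c for the generating function of the words c w over [k], where x marks the length of w and
-- y the occurrences of τ = m τ′ m in c w; removing the first letter gives F = 1 + x (A_1 + ⋯ + A_k).
-- An occurrence starts at the largest letter of its factor, so when c w begins with an occurrence
-- c u c no occurrence starts inside u, and the occurrences of c w are this one together with those of
-- the remaining word c w′. The factors u with c u c ≅ τ correspond to the choices of m - 1 letters
-- below c, so there are C(c-1, m-1) of them, and splitting the words c w according to whether they
-- begin with an occurrence gives (1 + C(c-1, m-1) x^(l-1) (1 - y)) A_c = F. For c < m the binomial
-- vanishes and A_c = F; otherwise A_c = E_(c-1) F, and F = 1 + x Σ A_c becomes the claimed identity.

open import Algebra.Properties.CommutativeSemigroup using (interchange)
open import Data.Bool using (Bool; true; false; _∧_; not; if_then_else_; T)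
open import Data.Bool.Properties using (T-∧; T-≡)
open import Data.Empty using (⊥-elim)
open import Data.Integer as ℤ using (ℤ; +_; -_)
import Data.Integer.Properties as ℤ
open import Data.Integer.Tactic.RingSolver using (solve-∀)
open import Data.List using (List; []; _∷_; _++_; map; concatMap; upTo; applyUpTo; length; zip; take)
import Data.List.Properties as List
open import Data.List.Membership.Propositional using (_∈_; _∉_; find)
open import Data.List.Membership.Propositional.Properties
  using (∈-map⁺; ∈-map⁻; ∈-upTo⁺; ∈-upTo⁻; ∈-concatMap⁻; ∈-++⁺ˡ; ∈-++⁺ʳ; ∈-++⁻)
open import Data.List.Relation.Unary.All as All using (All; []; _∷_)
import Data.List.Relation.Unary.All.Properties as All
open import Data.List.Relation.Unary.AllPairs using ([]; _∷_)
open import Data.List.Relation.Unary.Any using (here; there)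
open import Data.List.Relation.Unary.Unique.Propositional using (Unique)
import Data.List.Relation.Unary.Unique.Propositional.Properties as Unique
open import Data.Nat as ℕ using (ℕ; zero; suc; _∸_; _≤_; _<_; _≡ᵇ_; z≤n; s≤s)
open import Data.Nat.Combinatorics using (_C_; nCk+nC[k+1]≡[n+1]C[k+1]; k>n⇒nCk≡0)
open import Data.Nat.ListAction using (sum)
open import Data.Nat.ListAction.Properties using (sum-++)
import Data.Nat.Properties as ℕ
open import Data.Product using (_×_; _,_; proj₁; proj₂; ∃)
open import Data.Sum using (_⊎_; inj₁; inj₂)
open import Function using (_∘_; _⇔_; mk⇔; Equivalence)
open import Relation.Binary.Bundles using (Setoid)
open import Relation.Binary.Definitions using (DecidableEquality; tri<; tri≈; tri>)
open import Relation.Binary.PropositionalEquality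
import Relation.Binary.Reasoning.Setoid as SetoidReasoning
open import Relation.Nullary using (¬_; Dec; does; yes; no)
open import Relation.Nullary.Decidable using (does-⇔; dec-true; dec-false)
open import Defs

-- Sums of natural numbers over lists

𝟙 : Bool → ℕ
𝟙 b = if b then 1 else 0

∑ : {A : Set} → (A → ℕ) → List A → ℕ
∑ f xs = sum (map f xs)

syntax ∑ (λ x → e) xs = ∑[ x ← xs ] e

module _ {A : Set} where

  ∑-cong : ∀ (xs : List A) {f g : A → ℕ} → (∀ {x} → x ∈ xs → f x ≡ g x) → ∑ f xs ≡ ∑ g xs
  ∑-cong []       f≡g = refl
  ∑-cong (x ∷ xs) f≡g = cong₂ ℕ._+_ (f≡g (here refl)) (∑-cong xs (f≡g ∘ there))

  ∑-zero : ∀ (xs : List A) {f : A → ℕ} → (∀ {x} → x ∈ xs → f x ≡ 0) → ∑ f xs ≡ 0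
  ∑-zero []       f≡0 = refl
  ∑-zero (x ∷ xs) f≡0 = cong₂ ℕ._+_ (f≡0 (here refl)) (∑-zero xs (f≡0 ∘ there))

  ∑-1 : ∀ (xs : List A) → ∑[ x ← xs ] 1 ≡ length xs
  ∑-1 []       = refl
  ∑-1 (x ∷ xs) = cong suc (∑-1 xs)

  ∑-++ : ∀ (f : A → ℕ) xs ys → ∑ f (xs ++ ys) ≡ ∑ f xs ℕ.+ ∑ f ys
  ∑-++ f xs ys = trans (cong sum (List.map-++ f xs ys)) (sum-++ (map f xs) (map f ys))

  ∑-+ : ∀ (f g : A → ℕ) xs → ∑[ x ← xs ] (f x ℕ.+ g x) ≡ ∑ f xs ℕ.+ ∑ g xs
  ∑-+ f g []       = refl
  ∑-+ f g (x ∷ xs) = trans (cong (f x ℕ.+ g x ℕ.+_) (∑-+ f g xs))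
                           (interchange ℕ.+-commutativeSemigroup (f x) (g x) _ _)

  ∑-*ˡ : ∀ c (f : A → ℕ) xs → ∑[ x ← xs ] (c ℕ.* f x) ≡ c ℕ.* ∑ f xs
  ∑-*ˡ c f []       = sym (ℕ.*-zeroʳ c)
  ∑-*ˡ c f (x ∷ xs) = trans (cong (c ℕ.* f x ℕ.+_) (∑-*ˡ c f xs)) (sym (ℕ.*-distribˡ-+ c (f x) (∑ f xs)))

  ∑-*ʳ : ∀ c (f : A → ℕ) xs → ∑[ x ← xs ] (f x ℕ.* c) ≡ ∑ f xs ℕ.* c
  ∑-*ʳ c f []       = refl
  ∑-*ʳ c f (x ∷ xs) = trans (cong (f x ℕ.* c ℕ.+_) (∑-*ʳ c f xs)) (sym (ℕ.*-distribʳ-+ c (f x) (∑ f xs)))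

  ∑-single : ∀ {xs : List A} {x} {f : A → ℕ} → Unique xs → x ∈ xs →
             (∀ {y} → y ∈ xs → y ≢ x → f y ≡ 0) → ∑ f xs ≡ f x
  ∑-single {x ∷ xs} {f = f} (x∉xs ∷ _) (here refl) f≡0 =
    trans (cong (f x ℕ.+_) (∑-zero xs λ y∈xs → f≡0 (there y∈xs) (≢-sym (All.lookup x∉xs y∈xs))))
          (ℕ.+-identityʳ (f x))
  ∑-single {y ∷ xs} (y∉xs ∷ xs-unique) (there x∈xs) f≡0 =
    cong₂ ℕ._+_ (f≡0 (here refl) (All.lookup y∉xs x∈xs)) (∑-single xs-unique x∈xs (f≡0 ∘ there))

module _ {A B : Set} where

  ∑-map : ∀ (f : B → ℕ) (g : A → B) xs → ∑ f (map g xs) ≡ ∑ (f ∘ g) xs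
  ∑-map f g xs = cong sum (sym (List.map-∘ xs))

  ∑-concatMap : ∀ (f : B → ℕ) (g : A → List B) xs → ∑ f (concatMap g xs) ≡ ∑[ x ← xs ] ∑ f (g x)
  ∑-concatMap f g []       = refl
  ∑-concatMap f g (x ∷ xs) =
    trans (∑-++ f (g x) (concatMap g xs)) (cong (∑ f (g x) ℕ.+_) (∑-concatMap f g xs))

  ∑-swap : ∀ (h : A → B → ℕ) xs ys → ∑[ x ← xs ] ∑[ y ← ys ] h x y ≡ ∑[ y ← ys ] ∑[ x ← xs ] h x y
  ∑-swap h []       ys = sym (∑-zero ys (λ _ → refl))
  ∑-swap h (x ∷ xs) ys =
    trans (cong (∑ (h x) ys ℕ.+_) (∑-swap h xs ys)) (sym (∑-+ (h x) (λ y → ∑[ x′ ← xs ] h x′ y) ys))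

-- Formal power series

module PowerSeries where

  open import Data.Integer using (_+_; _-_; _*_)

  sumBelow-cong-< : ∀ n {f g : ℕ → ℤ} → (∀ i → i < n → f i ≡ g i) → sumBelow n f ≡ sumBelow n g
  sumBelow-cong-< zero    f≡g = refl
  sumBelow-cong-< (suc n) f≡g =
    cong₂ _+_ (sumBelow-cong-< n (λ i i<n → f≡g i (ℕ.m<n⇒m<1+n i<n))) (f≡g n (ℕ.n<1+n n))

  sumBelow-cong : ∀ n {f g : ℕ → ℤ} → (∀ i → f i ≡ g i) → sumBelow n f ≡ sumBelow n g
  sumBelow-cong n f≡g = sumBelow-cong-< n (λ i _ → f≡g i)

  sumBelow-zero : ∀ n {f : ℕ → ℤ} → (∀ i → i < n → f i ≡ + 0) → sumBelow n f ≡ + 0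
  sumBelow-zero zero    f≡0 = refl
  sumBelow-zero (suc n) f≡0 =
    cong₂ _+_ (sumBelow-zero n (λ i i<n → f≡0 i (ℕ.m<n⇒m<1+n i<n))) (f≡0 n (ℕ.n<1+n n))

  sumBelow-single : ∀ n {a} {f : ℕ → ℤ} → a < n → (∀ i → i < n → i ≢ a → f i ≡ + 0) →
                    sumBelow n f ≡ f a
  sumBelow-single (suc n) {a} {f} a<1+n f≡0 with ℕ.m≤n⇒m<n∨m≡n (ℕ.s≤s⁻¹ a<1+n)
  ... | inj₁ a<n = begin
    sumBelow n f + f n  ≡⟨ cong₂ _+_ (sumBelow-single n a<n (λ i i<n → f≡0 i (ℕ.m<n⇒m<1+n i<n)))
                                          (f≡0 n (ℕ.n<1+n n) (ℕ.>⇒≢ a<n)) ⟩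
    f a + + 0           ≡⟨ ℤ.+-identityʳ (f a) ⟩
    f a                   ∎
    where open ≡-Reasoning
  ... | inj₂ refl =
    trans (cong (_+ f n) (sumBelow-zero n (λ i i<n → f≡0 i (ℕ.m<n⇒m<1+n i<n) (ℕ.<⇒≢ i<n))))
          (ℤ.+-identityˡ (f n))

  sumBelow-head : ∀ n (f : ℕ → ℤ) → sumBelow (suc n) f ≡ f 0 + sumBelow n (f ∘ suc)
  sumBelow-head zero    f = ℤ.+-comm (+ 0) (f 0)
  sumBelow-head (suc n) f = trans (cong (_+ f (suc n)) (sumBelow-head n f)) (ℤ.+-assoc (f 0) _ _)

  sumBelow-+ : ∀ n (f g : ℕ → ℤ) → sumBelow n (λ i → f i + g i) ≡ sumBelow n f + sumBelow n g
  sumBelow-+ zero    f g = refl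
  sumBelow-+ (suc n) f g =
    trans (cong (_+ (f n + g n)) (sumBelow-+ n f g))
          (interchange ℤ.+-commutativeSemigroup (sumBelow n f) (sumBelow n g) (f n) (g n))

  *-distribˡ-sumBelow : ∀ n c (f : ℕ → ℤ) → c * sumBelow n f ≡ sumBelow n (λ i → c * f i)
  *-distribˡ-sumBelow zero    c f = ℤ.*-zeroʳ c
  *-distribˡ-sumBelow (suc n) c f =
    trans (ℤ.*-distribˡ-+ c (sumBelow n f) (f n)) (cong (_+ c * f n) (*-distribˡ-sumBelow n c f))

  *-distribʳ-sumBelow : ∀ n c (f : ℕ → ℤ) → sumBelow n f * c ≡ sumBelow n (λ i → f i * c)
  *-distribʳ-sumBelow n c f = begin
    sumBelow n f * c                ≡⟨ ℤ.*-comm (sumBelow n f) c ⟩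
    c * sumBelow n f                ≡⟨ *-distribˡ-sumBelow n c f ⟩
    sumBelow n (λ i → c * f i)      ≡⟨ sumBelow-cong n (λ i → ℤ.*-comm c (f i)) ⟩
    sumBelow n (λ i → f i * c)      ∎
    where open ≡-Reasoning

  neg-sumBelow : ∀ n (f : ℕ → ℤ) → - sumBelow n f ≡ sumBelow n (λ i → - f i)
  neg-sumBelow zero    f = refl
  neg-sumBelow (suc n) f = trans (ℤ.neg-distrib-+ (sumBelow n f) (f n)) (cong (_+ - f n) (neg-sumBelow n f))

  sumBelow-swap : ∀ n m (h : ℕ → ℕ → ℤ) →
    sumBelow n (λ i → sumBelow m (h i)) ≡ sumBelow m (λ j → sumBelow n (λ i → h i j))
  sumBelow-swap zero    m h = sym (sumBelow-zero m (λ _ _ → refl))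
  sumBelow-swap (suc n) m h = trans (cong (_+ sumBelow m (h n)) (sumBelow-swap n m h))
                                    (sym (sumBelow-+ m (λ j → sumBelow n (λ i → h i j)) (h n)))

  sumBelow-reverse : ∀ n (f : ℕ → ℤ) → sumBelow n f ≡ sumBelow n (λ i → f (n ∸ suc i))
  sumBelow-reverse zero    f = refl
  sumBelow-reverse (suc n) f = begin
    sumBelow n f + f n                                ≡⟨ cong (_+ f n) (sumBelow-reverse n f) ⟩
    sumBelow n (λ i → f (n ∸ suc i)) + f n            ≡⟨ ℤ.+-comm _ (f n) ⟩
    f n + sumBelow n (λ i → f (n ∸ suc i))            ≡⟨ sumBelow-head n (λ i → f (n ∸ i)) ⟨
    sumBelow (suc n) (λ i → f (n ∸ i))                  ∎
    where open ≡-Reasoning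

  sumBelow-triangle : ∀ N (U : ℕ → ℕ → ℤ) →
    sumBelow N (λ i → sumBelow (suc i) (U i)) ≡ sumBelow N (λ a → sumBelow (N ∸ a) (λ i → U (a ℕ.+ i) a))
  sumBelow-triangle zero    U = refl
  sumBelow-triangle (suc N) U = begin
    sumBelow N (λ i → sumBelow (suc i) (U i)) + sumBelow (suc N) (U N)
      ≡⟨ cong (_+ sumBelow (suc N) (U N)) (sumBelow-triangle N U) ⟩
    R + (sumBelow N (U N) + U N N)
      ≡⟨ ℤ.+-assoc R _ _ ⟨
    (R + sumBelow N (U N)) + U N N
      ≡⟨ cong₂ _+_ (sym (sumBelow-+ N _ _)) diagonal ⟩
    sumBelow N (λ a → column N a + U N a) + column (suc N) N
      ≡⟨ cong (_+ column (suc N) N) (sumBelow-cong-< N extend) ⟩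
    sumBelow N (column (suc N)) + column (suc N) N
      ∎
    where
    open ≡-Reasoning
    column : ℕ → ℕ → ℤ
    column M a = sumBelow (M ∸ a) (λ i → U (a ℕ.+ i) a)
    R = sumBelow N (column N)
    diagonal : U N N ≡ column (suc N) N
    diagonal rewrite ℕ.m+n∸n≡m 1 N | ℕ.+-identityʳ N = sym (ℤ.+-identityˡ (U N N))
    extend : ∀ a → a < N → column N a + U N a ≡ column (suc N) a
    extend a a<N rewrite ℕ.+-∸-assoc 1 (ℕ.<⇒≤ a<N) =
      cong (λ z → column N a + U z a) (sym (ℕ.m+[n∸m]≡n (ℕ.<⇒≤ a<N)))

  sumBelow-− : ∀ n (f g : ℕ → ℤ) → sumBelow n (λ i → f i - g i) ≡ sumBelow n f - sumBelow n g
  sumBelow-− n f g =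
    trans (sumBelow-+ n f (λ i → - g i)) (cong (λ z → sumBelow n f + z) (sym (neg-sumBelow n g)))

  ≈S-setoid : Setoid _ _
  ≈S-setoid = record
    { Carrier       = Series
    ; _≈_           = _≈S_
    ; isEquivalence = record
      { refl  = λ _ _ → refl
      ; sym   = λ f≈g n d → sym (f≈g n d)
      ; trans = λ f≈g g≈h n d → trans (f≈g n d) (g≈h n d)
      }
    }

  open Setoid ≈S-setoid public using () renaming (refl to ≈S-refl; sym to ≈S-sym; trans to ≈S-trans)
  module ≈S-Reasoning = SetoidReasoning ≈S-setoid

  ⊕-cong : ∀ {f f′ g g′} → f ≈S f′ → g ≈S g′ → (f ⊕ g) ≈S (f′ ⊕ g′)
  ⊕-cong f≈f′ g≈g′ n d = cong₂ _+_ (f≈f′ n d) (g≈g′ n d)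

  ⊛-cong : ∀ {f f′ g g′} → f ≈S f′ → g ≈S g′ → (f ⊛ g) ≈S (f′ ⊛ g′)
  ⊛-cong f≈f′ g≈g′ n d = sumBelow-cong (suc n) λ i → sumBelow-cong (suc d) λ j →
    cong₂ _*_ (f≈f′ i j) (g≈g′ (n ∸ i) (d ∸ j))

  ⊛-comm : ∀ f g → (f ⊛ g) ≈S (g ⊛ f)
  ⊛-comm f g n d = begin
    sumBelow (suc n) (λ i → sumBelow (suc d) (λ j → f i j * g (n ∸ i) (d ∸ j)))
      ≡⟨ sumBelow-reverse (suc n) _ ⟩
    sumBelow (suc n) (λ i → sumBelow (suc d) (λ j → f (n ∸ i) j * g (n ∸ (n ∸ i)) (d ∸ j)))
      ≡⟨ sumBelow-cong (suc n) (λ i → sumBelow-reverse (suc d) _) ⟩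
    sumBelow (suc n) (λ i → sumBelow (suc d) (λ j → f (n ∸ i) (d ∸ j) * g (n ∸ (n ∸ i)) (d ∸ (d ∸ j))))
      ≡⟨ sumBelow-cong-< (suc n) (λ i i≤n → sumBelow-cong-< (suc d) (λ j j≤d →
           trans (ℤ.*-comm (f (n ∸ i) (d ∸ j)) _)
                 (cong₂ (λ a b → g a b * f (n ∸ i) (d ∸ j))
                        (ℕ.m∸[m∸n]≡n (ℕ.s≤s⁻¹ i≤n)) (ℕ.m∸[m∸n]≡n (ℕ.s≤s⁻¹ j≤d))))) ⟩
    sumBelow (suc n) (λ i → sumBelow (suc d) (λ j → g i j * f (n ∸ i) (d ∸ j)))
      ∎
    where open ≡-Reasoning

  ⊛-assoc : ∀ f g h → ((f ⊛ g) ⊛ h) ≈S (f ⊛ (g ⊛ h))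
  ⊛-assoc f g h n d = begin
    sumBelow (suc n) (λ i → sumBelow (suc d) (λ j →
      sumBelow (suc i) (λ a → sumBelow (suc j) (λ b → f a b * g (i ∸ a) (j ∸ b))) * h (n ∸ i) (d ∸ j)))
      ≡⟨ sumBelow-cong (suc n) (λ i → sumBelow-cong (suc d) (λ j →
           trans (*-distribʳ-sumBelow (suc i) _ _)
                 (sumBelow-cong (suc i) (λ a → *-distribʳ-sumBelow (suc j) _ _)))) ⟩
    sumBelow (suc n) (λ i → sumBelow (suc d) (λ j →
      sumBelow (suc i) (λ a → sumBelow (suc j) (λ b → term i a j b))))
      ≡⟨ sumBelow-cong (suc n) (λ i → sumBelow-swap (suc d) (suc i) _) ⟩
    sumBelow (suc n) (λ i → sumBelow (suc i) (λ a →
      sumBelow (suc d) (λ j → sumBelow (suc j) (λ b → term i a j b))))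
      ≡⟨ sumBelow-cong (suc n) (λ i → sumBelow-cong (suc i) (λ a → sumBelow-triangle (suc d) (term i a))) ⟩
    sumBelow (suc n) (λ i → sumBelow (suc i) (λ a →
      sumBelow (suc d) (λ b → sumBelow (suc d ∸ b) (λ j → term i a (b ℕ.+ j) b))))
      ≡⟨ sumBelow-triangle (suc n) _ ⟩
    sumBelow (suc n) (λ a → sumBelow (suc n ∸ a) (λ i → sumBelow (suc d) (λ b →
      sumBelow (suc d ∸ b) (λ j → term (a ℕ.+ i) a (b ℕ.+ j) b))))
      ≡⟨ sumBelow-cong (suc n) (λ a → sumBelow-swap (suc n ∸ a) (suc d) _) ⟩
    sumBelow (suc n) (λ a → sumBelow (suc d) (λ b → sumBelow (suc n ∸ a) (λ i →
      sumBelow (suc d ∸ b) (λ j → term (a ℕ.+ i) a (b ℕ.+ j) b))))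
      ≡⟨ sumBelow-cong-< (suc n) (λ a a≤n → sumBelow-cong-< (suc d) (λ b b≤d →
           sym (factor-out a b (ℕ.s≤s⁻¹ a≤n) (ℕ.s≤s⁻¹ b≤d)))) ⟩
    sumBelow (suc n) (λ a → sumBelow (suc d) (λ b → f a b *
      sumBelow (suc (n ∸ a)) (λ i → sumBelow (suc (d ∸ b)) (λ j → g i j * h (n ∸ a ∸ i) (d ∸ b ∸ j)))))
      ∎
    where
    open ≡-Reasoning
    term : ℕ → ℕ → ℕ → ℕ → ℤ
    term i a j b = f a b * g (i ∸ a) (j ∸ b) * h (n ∸ i) (d ∸ j)
    reindex : ∀ a b i j → f a b * (g i j * h (n ∸ a ∸ i) (d ∸ b ∸ j)) ≡ term (a ℕ.+ i) a (b ℕ.+ j) b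
    reindex a b i j rewrite ℕ.m+n∸m≡n a i | ℕ.m+n∸m≡n b j | ℕ.∸-+-assoc n a i | ℕ.∸-+-assoc d b j =
      sym (ℤ.*-assoc (f a b) (g i j) _)
    factor-out : ∀ a b → a ≤ n → b ≤ d →
      f a b * sumBelow (suc (n ∸ a)) (λ i → sumBelow (suc (d ∸ b)) (λ j → g i j * h (n ∸ a ∸ i) (d ∸ b ∸ j)))
        ≡ sumBelow (suc n ∸ a) (λ i → sumBelow (suc d ∸ b) (λ j → term (a ℕ.+ i) a (b ℕ.+ j) b))
    factor-out a b a≤n b≤d rewrite ℕ.+-∸-assoc 1 a≤n | ℕ.+-∸-assoc 1 b≤d =
      trans (*-distribˡ-sumBelow (suc (n ∸ a)) (f a b) _)
            (sumBelow-cong (suc (n ∸ a)) λ i → trans (*-distribˡ-sumBelow (suc (d ∸ b)) (f a b) _)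
                                                     (sumBelow-cong (suc (d ∸ b)) (reindex a b i)))

  ⊛-distribʳ-⊕ : ∀ f g h → ((f ⊕ g) ⊛ h) ≈S ((f ⊛ h) ⊕ (g ⊛ h))
  ⊛-distribʳ-⊕ f g h n d =
    trans (sumBelow-cong (suc n) λ i →
             trans (sumBelow-cong (suc d) (λ j → ℤ.*-distribʳ-+ (h (n ∸ i) (d ∸ j)) (f i j) (g i j)))
                   (sumBelow-+ (suc d) _ _))
          (sumBelow-+ (suc n) _ _)

  ⊛-distribʳ-⊖ : ∀ f g h → ((f ⊖ g) ⊛ h) ≈S ((f ⊛ h) ⊖ (g ⊛ h))
  ⊛-distribʳ-⊖ f g h n d =
    trans (sumBelow-cong (suc n) λ i →
             trans (sumBelow-cong (suc d) (λ j → *-distribʳ-− (f i j) (g i j) (h (n ∸ i) (d ∸ j))))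
                   (sumBelow-− (suc d) _ _))
          (sumBelow-− (suc n) _ _)
    where
    *-distribʳ-− : ∀ a b c → (a - b) * c ≡ a * c - b * c
    *-distribʳ-− = solve-∀

  •-⊛ : ∀ c f h → ((c • f) ⊛ h) ≈S (c • (f ⊛ h))
  •-⊛ c f h n d = sym (trans (*-distribˡ-sumBelow (suc n) c _) (sumBelow-cong (suc n) λ i →
    trans (*-distribˡ-sumBelow (suc d) c _) (sumBelow-cong (suc d) λ j → sym (ℤ.*-assoc c _ _))))

  ⊛-zeroˡ : ∀ h → (zeroS ⊛ h) ≈S zeroS
  ⊛-zeroˡ h n d = sumBelow-zero (suc n) (λ _ _ → sumBelow-zero (suc d) (λ _ _ → refl))

  SupportedAt : ℕ → ℕ → Series → Set
  SupportedAt a b f = ∀ i j → i ≢ a ⊎ j ≢ b → f i j ≡ + 0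

  ⊛-supportedˡ : ∀ {a b f} h {n d} → SupportedAt a b f → a ≤ n → b ≤ d →
                 (f ⊛ h) n d ≡ f a b * h (n ∸ a) (d ∸ b)
  ⊛-supportedˡ {a} {b} {f} h {n} {d} f-at a≤n b≤d =
    trans (sumBelow-single (suc n) (s≤s a≤n) λ i _ i≢a →
             sumBelow-zero (suc d) λ j _ → cong (_* h (n ∸ i) (d ∸ j)) (f-at i j (inj₁ i≢a)))
          (sumBelow-single (suc d) (s≤s b≤d) λ j _ j≢b → cong (_* h (n ∸ a) (d ∸ j)) (f-at a j (inj₂ j≢b)))

  ⊛-supportedˡ-outside : ∀ {a b f} h {n d} → SupportedAt a b f → ¬ (a ≤ n × b ≤ d) → (f ⊛ h) n d ≡ + 0
  ⊛-supportedˡ-outside {a} {b} {f} h {n} {d} f-at outside =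
    sumBelow-zero (suc n) λ i i≤n → sumBelow-zero (suc d) λ j j≤d →
      cong (_* h (n ∸ i) (d ∸ j)) (f-at i j (off-support i≤n j≤d))
    where
    off-support : ∀ {i j} → i < suc n → j < suc d → i ≢ a ⊎ j ≢ b
    off-support {i} {j} i≤n j≤d with i ℕ.≟ a | j ℕ.≟ b
    ... | yes refl | yes refl = ⊥-elim (outside (ℕ.s≤s⁻¹ i≤n , ℕ.s≤s⁻¹ j≤d))
    ... | no i≢a   | _        = inj₁ i≢a
    ... | yes _    | no j≢b   = inj₂ j≢b

  oneS-supported : SupportedAt 0 0 oneS
  oneS-supported zero    zero    (inj₁ 0≢0) = ⊥-elim (0≢0 refl)
  oneS-supported zero    zero    (inj₂ 0≢0) = ⊥-elim (0≢0 refl)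
  oneS-supported zero    (suc j) _          = refl
  oneS-supported (suc i) j       _          = refl

  X-supported : SupportedAt 1 0 X
  X-supported (suc zero)    zero    (inj₁ 1≢1) = ⊥-elim (1≢1 refl)
  X-supported (suc zero)    zero    (inj₂ 0≢0) = ⊥-elim (0≢0 refl)
  X-supported (suc zero)    (suc j) _          = refl
  X-supported zero          j       _          = refl
  X-supported (suc (suc i)) j       _          = refl

  Y-supported : SupportedAt 0 1 Y
  Y-supported zero    (suc zero)    (inj₁ 0≢0) = ⊥-elim (0≢0 refl)
  Y-supported zero    (suc zero)    (inj₂ 1≢1) = ⊥-elim (1≢1 refl)
  Y-supported zero    zero          _          = refl
  Y-supported zero    (suc (suc j)) _          = refl
  Y-supported (suc i) j             _          = refl

  ⊛-identityˡ : ∀ h → (oneS ⊛ h) ≈S h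
  ⊛-identityˡ h n d = trans (⊛-supportedˡ h oneS-supported z≤n z≤n) (ℤ.*-identityˡ (h n d))

  X-⊛-suc : ∀ h n d → (X ⊛ h) (suc n) d ≡ h n d
  X-⊛-suc h n d = trans (⊛-supportedˡ h X-supported (s≤s z≤n) z≤n) (ℤ.*-identityˡ (h n d))

  X-⊛-zero : ∀ h d → (X ⊛ h) zero d ≡ + 0
  X-⊛-zero h d = ⊛-supportedˡ-outside h {zero} {d} X-supported λ ()

  Y-⊛-suc : ∀ h n d → (Y ⊛ h) n (suc d) ≡ h n d
  Y-⊛-suc h n d = trans (⊛-supportedˡ h Y-supported z≤n (s≤s z≤n)) (ℤ.*-identityˡ (h n d))

  Y-⊛-zero : ∀ h n → (Y ⊛ h) n zero ≡ + 0
  Y-⊛-zero h n = ⊛-supportedˡ-outside h {n} {zero} Y-supported λ ()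

  X^-⊛-+ : ∀ a h r d → ((X ^S a) ⊛ h) (a ℕ.+ r) d ≡ h r d
  X^-⊛-+ zero    h r d = ⊛-identityˡ h r d
  X^-⊛-+ (suc a) h r d =
    trans (⊛-assoc X (X ^S a) h (suc (a ℕ.+ r)) d)
          (trans (X-⊛-suc ((X ^S a) ⊛ h) (a ℕ.+ r) d) (X^-⊛-+ a h r d))

  X^-⊛-< : ∀ a h {n} d → n < a → ((X ^S a) ⊛ h) n d ≡ + 0
  X^-⊛-< (suc a) h {zero}  d _         = trans (⊛-assoc X (X ^S a) h zero d) (X-⊛-zero ((X ^S a) ⊛ h) d)
  X^-⊛-< (suc a) h {suc n} d (s≤s n<a) =
    trans (⊛-assoc X (X ^S a) h (suc n) d) (trans (X-⊛-suc ((X ^S a) ⊛ h) n d) (X^-⊛-< a h d n<a))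

  sumS-cong : ∀ js {E E′ : ℕ → Series} → (∀ {j} → j ∈ js → E j ≈S E′ j) → sumS js E ≈S sumS js E′
  sumS-cong []       E≈E′ = ≈S-refl
  sumS-cong (j ∷ js) E≈E′ = ⊕-cong (E≈E′ (here refl)) (sumS-cong js (E≈E′ ∘ there))

  sumS-++ : ∀ is js (E : ℕ → Series) → sumS (is ++ js) E ≈S (sumS is E ⊕ sumS js E)
  sumS-++ []       js E n d = sym (ℤ.+-identityˡ _)
  sumS-++ (i ∷ is) js E n d =
    trans (cong (λ z → E i n d + z) (sumS-++ is js E n d)) (sym (ℤ.+-assoc (E i n d) _ _))

  sumS-const : ∀ js h → sumS js (λ _ → h) ≈S ((+ length js) • h)
  sumS-const []       h n d = refl
  sumS-const (j ∷ js) h n d = begin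
    h n d + sumS js (λ _ → h) n d        ≡⟨ cong (λ z → h n d + z) (sumS-const js h n d) ⟩
    h n d + + length js * h n d          ≡⟨ cong (_+ (+ length js * h n d)) (ℤ.*-identityˡ (h n d)) ⟨
    + 1 * h n d + + length js * h n d    ≡⟨ ℤ.*-distribʳ-+ (h n d) (+ 1) (+ length js) ⟨
    + suc (length js) * h n d            ∎
    where open ≡-Reasoning

  sumS-⊛ : ∀ js (E : ℕ → Series) h → (sumS js E ⊛ h) ≈S sumS js (λ j → E j ⊛ h)
  sumS-⊛ []       E h = ⊛-zeroˡ h
  sumS-⊛ (j ∷ js) E h n d =
    trans (⊛-distribʳ-⊕ (E j) (sumS js E) h n d) (cong (λ z → (E j ⊛ h) n d + z) (sumS-⊛ js E h n d))

  ⊛-sumS : ∀ h js (E : ℕ → Series) → (h ⊛ sumS js E) ≈S sumS js (λ j → h ⊛ E j)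
  ⊛-sumS h js E n d =
    trans (⊛-comm h (sumS js E) n d)
          (trans (sumS-⊛ js E h n d) (sumS-cong js (λ {j} _ → ⊛-comm (E j) h) n d))

  ⊖-⊖ : ∀ f g h → ((f ⊖ g) ⊖ h) ≈S (f ⊖ (g ⊕ h))
  ⊖-⊖ f g h n d = minus-minus (f n d) (g n d) (h n d)
    where
    minus-minus : ∀ a b c → a - b - c ≡ a - (b + c)
    minus-minus = solve-∀

  ⊛-solve : ∀ {D E A B} → (D ⊛ E) ≈S oneS → (D ⊛ A) ≈S B → A ≈S (E ⊛ B)
  ⊛-solve {D} {E} {A} {B} D⊛E≈1 D⊛A≈B = begin
    A               ≈⟨ ⊛-identityˡ A ⟨
    oneS ⊛ A        ≈⟨ ⊛-cong {oneS} {D ⊛ E} {A} {A} (≈S-sym {D ⊛ E} {oneS} D⊛E≈1) (≈S-refl {A}) ⟩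
    (D ⊛ E) ⊛ A     ≈⟨ ⊛-cong {D ⊛ E} {E ⊛ D} {A} {A} (⊛-comm D E) (≈S-refl {A}) ⟩
    (E ⊛ D) ⊛ A     ≈⟨ ⊛-assoc E D A ⟩
    E ⊛ (D ⊛ A)     ≈⟨ ⊛-cong {E} {E} {D ⊛ A} {B} (≈S-refl {E}) D⊛A≈B ⟩
    E ⊛ B           ∎
    where open ≈S-Reasoning

  fixpoint⇒inverse : ∀ {U F} → F ≈S (oneS ⊕ (U ⊛ F)) → ((oneS ⊖ U) ⊛ F) ≈S oneS
  fixpoint⇒inverse {U} {F} F≈1+UF n d = begin
    ((oneS ⊖ U) ⊛ F) n d                  ≡⟨ ⊛-distribʳ-⊖ oneS U F n d ⟩
    (oneS ⊛ F) n d - (U ⊛ F) n d          ≡⟨ cong (_- (U ⊛ F) n d) (trans (⊛-identityˡ F n d) (F≈1+UF n d)) ⟩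
    oneS n d + (U ⊛ F) n d - (U ⊛ F) n d  ≡⟨ plus-minus (oneS n d) ((U ⊛ F) n d) ⟩
    oneS n d                              ∎
    where
    open ≡-Reasoning
    plus-minus : ∀ a b → a + b - b ≡ a
    plus-minus = solve-∀

  Dj-≈-oneS : ∀ m l j → j < m ∸ 1 → Dj m l j ≈S oneS
  Dj-≈-oneS m l j j<m∸1 n d =
    trans (cong (λ C → oneS n d + + C * ((X ^S (l ∸ 1)) ⊛ (oneS ⊖ Y)) n d) (k>n⇒nCk≡0 j<m∸1))
          (ℤ.+-identityʳ (oneS n d))

  sumS-coefficient : ∀ js (E : ℕ → Series) (f : ℕ → ℕ) {n d} → (∀ j → E j n d ≡ + f j) →
                     sumS js E n d ≡ + ∑ f js
  sumS-coefficient []       E f E≡f = refl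
  sumS-coefficient (j ∷ js) E f E≡f =
    trans (cong₂ _+_ (E≡f j) (sumS-coefficient js E f E≡f)) (sym (ℤ.pos-+ (f j) _))

open PowerSeries

-- Lists and words

module _ {A B : Set} where

  zip-++ : ∀ (xs : List A) (ys : List B) {xs′ ys′} → length xs ≡ length ys →
           zip (xs ++ xs′) (ys ++ ys′) ≡ zip xs ys ++ zip xs′ ys′
  zip-++ []       []       _         = refl
  zip-++ (x ∷ xs) (y ∷ ys) |xs|≡|ys| = cong ((x , y) ∷_) (zip-++ xs ys (ℕ.suc-injective |xs|≡|ys|))

  ∈-zip⁻ : ∀ (xs : List A) (ys : List B) {a b} → (a , b) ∈ zip xs ys → a ∈ xs × b ∈ ys
  ∈-zip⁻ (x ∷ xs) (y ∷ ys) (here refl) = here refl , here refl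
  ∈-zip⁻ (x ∷ xs) (y ∷ ys) (there ab∈) = let a∈ , b∈ = ∈-zip⁻ xs ys ab∈ in there a∈ , there b∈

  ∈-zipʳ : ∀ (xs : List A) (ys : List B) {b} → length xs ≡ length ys → b ∈ ys → ∃ λ a → (a , b) ∈ zip xs ys
  ∈-zipʳ (x ∷ xs) (y ∷ ys) _         (here refl) = x , here refl
  ∈-zipʳ (x ∷ xs) (y ∷ ys) |xs|≡|ys| (there b∈)  =
    let a , ab∈ = ∈-zipʳ xs ys (ℕ.suc-injective |xs|≡|ys|) b∈ in a , there ab∈

  zip-map-self : ∀ (g : A → B) xs → zip xs (map g xs) ≡ map (λ a → a , g a) xs
  zip-map-self g []       = refl
  zip-map-self g (x ∷ xs) = cong ((x , g x) ∷_) (zip-map-self g xs)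

  map-≡-zip : ∀ (g : A → B) xs ys → length xs ≡ length ys →
              (∀ {a b} → (a , b) ∈ zip xs ys → g a ≡ b) → map g xs ≡ ys
  map-≡-zip g []       []       _         _      = refl
  map-≡-zip g (x ∷ xs) (y ∷ ys) |xs|≡|ys| g≡zip =
    cong₂ _∷_ (g≡zip (here refl)) (map-≡-zip g xs ys (ℕ.suc-injective |xs|≡|ys|) (g≡zip ∘ there))

∈-take : ∀ (u : List ℕ) {c w n} → length u < n → c ∈ take n (u ++ c ∷ w)
∈-take []      {n = suc n} _         = here refl
∈-take (x ∷ u) {n = suc n} (s≤s |u|<n) = there (∈-take u |u|<n)

partner : ℕ → List (ℕ × ℕ) → ℕ
partner a []             = 0
partner a ((t , x) ∷ ps) with t ℕ.≟ a
... | yes _ = x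
... | no _  = partner a ps

partner-∈ : ∀ xs ys {a} → length xs ≡ length ys → a ∈ xs → (a , partner a (zip xs ys)) ∈ zip xs ys
partner-∈ (t ∷ xs) (y ∷ ys) {a} |xs|≡|ys| a∈ with t ℕ.≟ a | a∈
... | yes refl | _           = here refl
... | no t≢a   | here refl   = ⊥-elim (t≢a refl)
... | no _     | there a∈xs = there (partner-∈ xs ys (ℕ.suc-injective |xs|≡|ys|) a∈xs)

applyUpTo-cong-< : ∀ n {f g : ℕ → ℕ} → (∀ {i} → i < n → f i ≡ g i) → applyUpTo f n ≡ applyUpTo g n
applyUpTo-cong-< zero    f≡g = refl
applyUpTo-cong-< (suc n) f≡g = cong₂ _∷_ (f≡g (s≤s z≤n)) (applyUpTo-cong-< n (f≡g ∘ s≤s))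

applyUpTo-+ : ∀ (f : ℕ → ℕ) a b → applyUpTo f (a ℕ.+ b) ≡ applyUpTo f a ++ applyUpTo (λ i → f (a ℕ.+ i)) b
applyUpTo-+ f zero    b = refl
applyUpTo-+ f (suc a) b = cong (f 0 ∷_) (applyUpTo-+ (f ∘ suc) a b)

upTo-range : ∀ {a b} → a < b → upTo b ≡ upTo a ++ range a (b ∸ 1)
upTo-range {a} {suc b} a<1+b = begin
  upTo (suc b)                              ≡⟨ cong upTo (ℕ.m+[n∸m]≡n (ℕ.<⇒≤ a<1+b)) ⟨
  upTo (a ℕ.+ (suc b ∸ a))                  ≡⟨ applyUpTo-+ (λ i → i) a (suc b ∸ a) ⟩
  upTo a ++ applyUpTo (a ℕ.+_) (suc b ∸ a)  ≡⟨ cong (upTo a ++_) (List.map-upTo (a ℕ.+_) (suc b ∸ a)) ⟨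
  upTo a ++ range a b                       ∎
  where open ≡-Reasoning

_≟ᴸ_ : DecidableEquality (List ℕ)
_≟ᴸ_ = List.≡-dec ℕ._≟_

Letter : ℕ → ℕ → Set
Letter k a = 1 ≤ a × a ≤ k

letters-unique : ∀ k → Unique (letters k)
letters-unique k = Unique.map⁺ ℕ.suc-injective (Unique.upTo⁺ k)

∈-letters⁺ : ∀ {k a} → Letter k a → a ∈ letters k
∈-letters⁺ {a = suc a} (_ , a<k) = ∈-map⁺ suc (∈-upTo⁺ a<k)

∈-letters⁻ : ∀ {k a} → a ∈ letters k → Letter k a
∈-letters⁻ a∈ with _ , i∈ , refl ← ∈-map⁻ suc a∈ = s≤s z≤n , ∈-upTo⁻ i∈

∑-words-suc : ∀ k n (f : List ℕ → ℕ) →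
  ∑ f (words k (suc n)) ≡ ∑[ a ← letters k ] ∑[ w ← words k n ] f (a ∷ w)
∑-words-suc k n f = trans (∑-concatMap f (λ a → map (a ∷_) (words k n)) (letters k))
                          (∑-cong (letters k) λ {a} _ → ∑-map f (a ∷_) (words k n))

∈-words⁻ : ∀ {k} n {w} → w ∈ words k n → length w ≡ n × All (Letter k) w
∈-words⁻ zero    (here refl) = refl , []
∈-words⁻ {k} (suc n) w∈
  with a , a∈ , w∈a∷ ← find (∈-concatMap⁻ (λ a → map (a ∷_) (words k n)) {xs = letters k} w∈)
  with u , u∈ , refl ← ∈-map⁻ (a ∷_) w∈a∷
  with refl , u-letters ← ∈-words⁻ n u∈
  = refl , ∈-letters⁻ a∈ ∷ u-letters

∑-words-++ : ∀ k a b (f : List ℕ → ℕ) →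
  ∑ f (words k (a ℕ.+ b)) ≡ ∑[ u ← words k a ] ∑[ v ← words k b ] f (u ++ v)
∑-words-++ k zero    b f = sym (ℕ.+-identityʳ _)
∑-words-++ k (suc a) b f = begin
  ∑ f (words k (suc (a ℕ.+ b)))
    ≡⟨ ∑-words-suc k (a ℕ.+ b) f ⟩
  ∑[ x ← letters k ] ∑[ w ← words k (a ℕ.+ b) ] f (x ∷ w)
    ≡⟨ ∑-cong (letters k) (λ {x} _ → ∑-words-++ k a b (f ∘ (x ∷_))) ⟩
  ∑[ x ← letters k ] ∑[ u ← words k a ] ∑[ v ← words k b ] f (x ∷ u ++ v)
    ≡⟨ ∑-words-suc k a (λ u → ∑[ v ← words k b ] f (u ++ v)) ⟨
  ∑[ u ← words k (suc a) ] ∑[ v ← words k b ] f (u ++ v)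
    ∎
  where open ≡-Reasoning

∑-words-single : ∀ {k n} w {f : List ℕ → ℕ} → length w ≡ n → All (Letter k) w →
                 (∀ u → u ≢ w → f u ≡ 0) → ∑ f (words k n) ≡ f w
∑-words-single []          {f} refl []                       f≡0 = ℕ.+-identityʳ (f [])
∑-words-single {k} (x ∷ w) {f} refl (x-letter ∷ w-letters) f≡0 = begin
  ∑ f (words k (suc (length w)))
    ≡⟨ ∑-words-suc k (length w) f ⟩
  ∑[ a ← letters k ] ∑[ u ← words k (length w) ] f (a ∷ u)
    ≡⟨ ∑-single (letters-unique k) (∈-letters⁺ x-letter)
         (λ {a} _ a≢x → ∑-zero (words k (length w)) λ {u} _ → f≡0 (a ∷ u) (a≢x ∘ List.∷-injectiveˡ)) ⟩
  ∑[ u ← words k (length w) ] f (x ∷ u)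
    ≡⟨ ∑-words-single w refl w-letters (λ u u≢w → f≡0 (x ∷ u) (u≢w ∘ List.∷-injectiveʳ)) ⟩
  f (x ∷ w)
    ∎
  where open ≡-Reasoning

countWith-∑ : ∀ τ d σs → countWith τ d σs ≡ ∑[ σ ← σs ] 𝟙 (occurrences τ σ ≡ᵇ d)
countWith-∑ τ d []       = refl
countWith-∑ τ d (σ ∷ σs) = cong (𝟙 (occurrences τ σ ≡ᵇ d) ℕ.+_) (countWith-∑ τ d σs)

-- Order isomorphism

⇔ᵇ-⇔ : ∀ a b → T (a ⇔ᵇ b) ⇔ (a ≡ b)
⇔ᵇ-⇔ true  true  = mk⇔ (λ _ → refl) _
⇔ᵇ-⇔ true  false = mk⇔ (λ ()) (λ ())
⇔ᵇ-⇔ false true  = mk⇔ (λ ()) (λ ())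
⇔ᵇ-⇔ false false = mk⇔ (λ _ → refl) _

does-≡⇒⇔ : ∀ {P Q : Set} (p? : Dec P) (q? : Dec Q) → does p? ≡ does q? → P ⇔ Q
does-≡⇒⇔ (yes p) (yes q) _ = mk⇔ (λ _ → q) (λ _ → p)
does-≡⇒⇔ (no ¬p) (no ¬q) _ = mk⇔ (⊥-elim ∘ ¬p) (⊥-elim ∘ ¬q)

Compatible : ℕ × ℕ → ℕ × ℕ → Set
Compatible (a , x) (b , y) = (a < b ⇔ x < y) × (a ≡ b ⇔ x ≡ y)

compatible-⇔ : ∀ p q → T (compatible p q) ⇔ Compatible p q
compatible-⇔ (a , x) (b , y) = mk⇔
  (λ t → let t< , t≡ = Equivalence.to T-∧ t in
     does-≡⇒⇔ (a ℕ.<? b) (x ℕ.<? y) (Equivalence.to (⇔ᵇ-⇔ _ _) t<) ,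
     does-≡⇒⇔ (a ℕ.≟ b) (x ℕ.≟ y) (Equivalence.to (⇔ᵇ-⇔ _ _) t≡))
  (λ (<⇔< , ≡⇔≡) → Equivalence.from T-∧
     ( Equivalence.from (⇔ᵇ-⇔ _ _) (does-⇔ <⇔< (a ℕ.<? b) (x ℕ.<? y))
     , Equivalence.from (⇔ᵇ-⇔ _ _) (does-⇔ ≡⇔≡ (a ℕ.≟ b) (x ℕ.≟ y))))

strictMono⇒Compatible : ∀ {a b} (ψ : ℕ → ℕ) → (a < b → ψ a < ψ b) → (b < a → ψ b < ψ a) →
                        Compatible (a , ψ a) (b , ψ b)
strictMono⇒Compatible {a} {b} ψ mono-ab mono-ba with ℕ.<-cmp a b
... | tri< a<b a≢b _ =
  mk⇔ (λ _ → mono-ab a<b) (λ _ → a<b) , mk⇔ (⊥-elim ∘ a≢b) (⊥-elim ∘ ℕ.<⇒≢ (mono-ab a<b))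
... | tri≈ _ refl _ =
  mk⇔ (⊥-elim ∘ ℕ.<-irrefl refl) (⊥-elim ∘ ℕ.<-irrefl refl) , mk⇔ (λ _ → refl) (λ _ → refl)
... | tri> _ a≢b b<a =
  mk⇔ (⊥-elim ∘ ℕ.<-asym b<a) (⊥-elim ∘ ℕ.<-asym (mono-ba b<a)) ,
  mk⇔ (⊥-elim ∘ a≢b) (⊥-elim ∘ ℕ.<⇒≢ (mono-ba b<a) ∘ sym)

module _ {A : Set} {p : A → Bool} where

  T-allB⁻ : ∀ {xs x} → T (allB p xs) → x ∈ xs → T (p x)
  T-allB⁻ {x ∷ _} t (here refl) = proj₁ (Equivalence.to T-∧ t)
  T-allB⁻ {y ∷ _} t (there x∈) = T-allB⁻ (proj₂ (Equivalence.to (T-∧ {p y}) t)) x∈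

  T-allB⁺ : ∀ xs → (∀ {x} → x ∈ xs → T (p x)) → T (allB p xs)
  T-allB⁺ []       _   = _
  T-allB⁺ (x ∷ xs) all = Equivalence.from T-∧ (all (here refl) , T-allB⁺ xs (all ∘ there))

orderIso⇒length : ∀ s t → T (orderIso s t) → length s ≡ length t
orderIso⇒length s t iso = ℕ.≡ᵇ⇒≡ _ _ (proj₁ (Equivalence.to T-∧ iso))

orderIso⇒Compatible : ∀ s t {p q} → T (orderIso s t) → p ∈ zip s t → q ∈ zip s t → Compatible p q
orderIso⇒Compatible s t {p} {q} iso p∈ q∈ = Equivalence.to (compatible-⇔ p q)
  (T-allB⁻ (T-allB⁻ (proj₂ (Equivalence.to (T-∧ {length s ℕ.≡ᵇ length t}) iso)) p∈) q∈)

orderIso-map : ∀ τ (ψ : ℕ → ℕ) → (∀ {a b} → a ∈ τ → b ∈ τ → a < b → ψ a < ψ b) →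
               T (orderIso τ (map ψ τ))
orderIso-map τ ψ mono = Equivalence.from T-∧
  ( ℕ.≡⇒≡ᵇ _ _ (sym (List.length-map ψ τ))
  , subst (λ ps → T (allB (λ p → allB (compatible p) ps) ps)) (sym (zip-map-self ψ τ))
      (T-allB⁺ pairs λ p∈ → T-allB⁺ pairs λ q∈ → compatible-pairs p∈ q∈))
  where
  pairs = map (λ a → a , ψ a) τ
  compatible-pairs : ∀ {p q} → p ∈ pairs → q ∈ pairs → T (compatible p q)
  compatible-pairs p∈ q∈
    with a , a∈ , refl ← ∈-map⁻ (λ a → a , ψ a) p∈
       | b , b∈ , refl ← ∈-map⁻ (λ a → a , ψ a) q∈ =
    Equivalence.from (compatible-⇔ _ _) (strictMono⇒Compatible ψ (mono a∈ b∈) (mono b∈ a∈))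

-- Strictly increasing sequences

data Increasing : ℕ → ℕ → ℕ → List ℕ → Set where
  []  : ∀ {lo hi} → Increasing 0 lo hi []
  _∷_ : ∀ {s lo hi x v} → lo < x × x ≤ hi → Increasing s x hi v → Increasing (suc s) lo hi (x ∷ v)

increasing : ℕ → ℕ → ℕ → List (List ℕ)
increasing zero    lo b       = [] ∷ []
increasing (suc s) lo zero    = []
increasing (suc s) lo (suc b) = map (suc lo ∷_) (increasing s (suc lo) b) ++ increasing (suc s) (suc lo) b

Increasing-length : ∀ {s lo hi v} → Increasing s lo hi v → length v ≡ s
Increasing-length []       = refl
Increasing-length (_ ∷ v↑) = cong suc (Increasing-length v↑)

Increasing-weaken : ∀ {s lo lo′ hi v} → lo′ ≤ lo → Increasing s lo hi v → Increasing s lo′ hi v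
Increasing-weaken lo′≤lo []                    = []
Increasing-weaken lo′≤lo ((lo<x , x≤hi) ∷ v↑) = (ℕ.≤-<-trans lo′≤lo lo<x , x≤hi) ∷ v↑

increasing-length : ∀ s lo b → length (increasing s lo b) ≡ b C s
increasing-length zero    lo b       = refl
increasing-length (suc s) lo zero    = refl
increasing-length (suc s) lo (suc b) = begin
  length (map (suc lo ∷_) (increasing s (suc lo) b) ++ increasing (suc s) (suc lo) b)
    ≡⟨ List.length-++ (map (suc lo ∷_) (increasing s (suc lo) b)) ⟩
  length (map (suc lo ∷_) (increasing s (suc lo) b)) ℕ.+ length (increasing (suc s) (suc lo) b)
    ≡⟨ cong₂ ℕ._+_ (trans (List.length-map (suc lo ∷_) (increasing s (suc lo) b))
                          (increasing-length s (suc lo) b))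
                   (increasing-length (suc s) (suc lo) b) ⟩
  b C s ℕ.+ b C suc s
    ≡⟨ nCk+nC[k+1]≡[n+1]C[k+1] b s ⟩
  suc b C suc s
    ∎
  where open ≡-Reasoning

module _ {s lo′ : ℕ} {v : List ℕ} (lo b : ℕ) where

  Increasing-+-suc : Increasing s lo′ (suc (lo ℕ.+ b)) v → Increasing s lo′ (lo ℕ.+ suc b) v
  Increasing-+-suc = subst (λ hi → Increasing s lo′ hi v) (sym (ℕ.+-suc lo b))

  Increasing-+-suc⁻ : Increasing s lo′ (lo ℕ.+ suc b) v → Increasing s lo′ (suc (lo ℕ.+ b)) v
  Increasing-+-suc⁻ = subst (λ hi → Increasing s lo′ hi v) (ℕ.+-suc lo b)

∈-increasing⁻ : ∀ s lo b {v} → v ∈ increasing s lo b → Increasing s lo (lo ℕ.+ b) v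
∈-increasing⁻ zero    lo b       (here refl) = []
∈-increasing⁻ (suc s) lo (suc b) v∈ with ∈-++⁻ (map (suc lo ∷_) (increasing s (suc lo) b)) v∈
... | inj₁ v∈head with v′ , v′∈ , refl ← ∈-map⁻ (suc lo ∷_) v∈head =
  (ℕ.n<1+n lo , ℕ.≤-trans (s≤s (ℕ.m≤m+n lo b)) (ℕ.≤-reflexive (sym (ℕ.+-suc lo b))))
  ∷ Increasing-+-suc lo b (∈-increasing⁻ s (suc lo) b v′∈)
... | inj₂ v∈tail =
  Increasing-+-suc lo b (Increasing-weaken (ℕ.n≤1+n lo) (∈-increasing⁻ (suc s) (suc lo) b v∈tail))

∈-increasing⁺ : ∀ s lo b {v} → Increasing s lo (lo ℕ.+ b) v → v ∈ increasing s lo b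
∈-increasing⁺ zero    lo b       []                   = here refl
∈-increasing⁺ (suc s) lo zero    ((lo<x , x≤lo+0) ∷ _) =
  ⊥-elim (ℕ.<-irrefl refl (ℕ.<-≤-trans lo<x (subst (_ ≤_) (ℕ.+-identityʳ lo) x≤lo+0)))
∈-increasing⁺ (suc s) lo (suc b) {x ∷ v} ((lo<x , x≤hi) ∷ v↑) with ℕ.m≤n⇒m<n∨m≡n lo<x
... | inj₂ refl = ∈-++⁺ˡ (∈-map⁺ (suc lo ∷_) (∈-increasing⁺ s (suc lo) b (Increasing-+-suc⁻ lo b v↑)))
... | inj₁ 1+lo<x = ∈-++⁺ʳ (map (suc lo ∷_) (increasing s (suc lo) b))
  (∈-increasing⁺ (suc s) (suc lo) b (Increasing-+-suc⁻ lo b ((1+lo<x , x≤hi) ∷ v↑)))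

increasing-unique : ∀ s lo b → Unique (increasing s lo b)
increasing-unique zero    lo b       = [] ∷ []
increasing-unique (suc s) lo zero    = []
increasing-unique (suc s) lo (suc b) =
  Unique.++⁺ (Unique.map⁺ List.∷-injectiveʳ (increasing-unique s (suc lo) b))
             (increasing-unique (suc s) (suc lo) b)
             disjoint
  where
  disjoint : ∀ {v} → ¬ (v ∈ map (suc lo ∷_) (increasing s (suc lo) b) × v ∈ increasing (suc s) (suc lo) b)
  disjoint (v∈head , v∈tail) with _ , _ , refl ← ∈-map⁻ (suc lo ∷_) v∈head
    with (1+lo<1+lo , _) ∷ _ ← ∈-increasing⁻ (suc s) (suc lo) b v∈tail = ℕ.<-irrefl refl 1+lo<1+lo

nth : List ℕ → ℕ → ℕ
nth []       _       = 0
nth (x ∷ xs) zero    = x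
nth (x ∷ xs) (suc i) = nth xs i

Increasing-nth : ∀ {s lo hi v} → Increasing s lo hi v → ∀ {i} → i < s → lo < nth v i × nth v i ≤ hi
Increasing-nth (x-bounds ∷ v↑) {zero}  _         = x-bounds
Increasing-nth ((lo<x , _) ∷ v↑) {suc i} (s≤s i<s) =
  let x<vᵢ , vᵢ≤hi = Increasing-nth v↑ i<s in ℕ.<-trans lo<x x<vᵢ , vᵢ≤hi

Increasing-nth-< : ∀ {s lo hi v} → Increasing s lo hi v → ∀ {i j} → i < j → j < s → nth v i < nth v j
Increasing-nth-< (_ ∷ v↑) {zero}  {suc j} _         (s≤s j<s) = proj₁ (Increasing-nth v↑ j<s)
Increasing-nth-< (_ ∷ v↑) {suc i} {suc j} (s≤s i<j) (s≤s j<s) = Increasing-nth-< v↑ i<j j<s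

applyUpTo-Increasing : ∀ n {lo hi} (g : ℕ → ℕ) → (∀ {i} → i < n → lo < g i × g i ≤ hi) →
  (∀ {i j} → i < j → j < n → g i < g j) → Increasing n lo hi (applyUpTo g n)
applyUpTo-Increasing zero    g bounds mono = []
applyUpTo-Increasing (suc n) g bounds mono =
  bounds (s≤s z≤n) ∷ applyUpTo-Increasing n (g ∘ suc)
                       (λ i<n → mono (s≤s z≤n) (s≤s i<n) , proj₂ (bounds (s≤s i<n)))
                       (λ i<j j<n → mono (s≤s i<j) (s≤s j<n))

nth-applyUpTo : ∀ n (g : ℕ → ℕ) {i} → i < n → nth (applyUpTo g n) i ≡ g i
nth-applyUpTo (suc n) g {zero}  _         = refl
nth-applyUpTo (suc n) g {suc i} (s≤s i<n) = nth-applyUpTo n (g ∘ suc) i<n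

applyUpTo-nth : ∀ v → applyUpTo (nth v) (length v) ≡ v
applyUpTo-nth []      = refl
applyUpTo-nth (x ∷ v) = cong (x ∷_) (applyUpTo-nth v)

-- Occurrences of m τ′ m

-- The largest letter m is written suc s so that m ∸ 1, as it appears in Dj and denominator, reduces to s.
module Pattern (k s : ℕ) (τ′ : List ℕ) (τ′-letters : All (Letter (suc s)) τ′) (m∉τ′ : suc s ∉ τ′)
               (covers : ∀ a → 1 ≤ a → a ≤ suc s → a ∈ (suc s ∷ τ′ ++ suc s ∷ [])) where

  open import Data.Integer using (_+_; _-_; _*_)

  m : ℕ
  m = suc s

  τ : List ℕ
  τ = m ∷ τ′ ++ m ∷ []

  L : ℕ
  L = length τ′

  occ : List ℕ → ℕ
  occ = occurrences τ

  startsOccurrence : ℕ → List ℕ → Bool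
  startsOccurrence c w = orderIso τ (take (length τ) (c ∷ w))

  window : ℕ → List ℕ → ℕ → Bool
  window c u b = orderIso τ (c ∷ u ++ b ∷ [])

  τ′-letter : ∀ {a} → a ∈ τ′ → 1 ≤ a × a < m
  τ′-letter a∈ with 1≤a , a≤m ← All.lookup τ′-letters a∈ =
    1≤a , ℕ.≤∧≢⇒< a≤m (λ { refl → m∉τ′ a∈ })

  τ′-covers : ∀ {a} → 1 ≤ a → a < m → a ∈ τ′
  τ′-covers {a} 1≤a (s≤s a≤s) with covers a 1≤a (ℕ.m≤n⇒m≤1+n a≤s)
  ... | here refl  = ⊥-elim (ℕ.<-irrefl refl (s≤s a≤s))
  ... | there a∈ with ∈-++⁻ τ′ a∈
  ...   | inj₁ a∈τ′        = a∈τ′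
  ...   | inj₂ (here refl) = ⊥-elim (ℕ.<-irrefl refl (s≤s a≤s))

  τ-letter : ∀ {a} → a ∈ τ → 1 ≤ a × a ≤ m
  τ-letter (here refl) = s≤s z≤n , ℕ.≤-refl
  τ-letter (there a∈) with ∈-++⁻ τ′ a∈
  ... | inj₁ a∈τ′        = All.lookup τ′-letters a∈τ′
  ... | inj₂ (here refl) = s≤s z≤n , ℕ.≤-refl

  length-τ′++m : length (τ′ ++ m ∷ []) ≡ suc L
  length-τ′++m = trans (List.length-++ τ′) (ℕ.+-comm L 1)

  module Window {c u b} (|u|≡L : length u ≡ L) (iso : T (window c u b)) where

    pairs-shape : zip τ (c ∷ u ++ b ∷ []) ≡ (m , c) ∷ zip τ′ u ++ (m , b) ∷ []
    pairs-shape = cong ((m , c) ∷_) (zip-++ τ′ u (sym |u|≡L))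

    window-compatible : ∀ {p q} → p ∈ (m , c) ∷ zip τ′ u ++ (m , b) ∷ [] →
                        q ∈ (m , c) ∷ zip τ′ u ++ (m , b) ∷ [] → Compatible p q
    window-compatible {p} {q} p∈ q∈ =
      orderIso⇒Compatible τ (c ∷ u ++ b ∷ []) {p} {q} iso (subst (p ∈_) (sym pairs-shape) p∈)
                                                        (subst (q ∈_) (sym pairs-shape) q∈)

    inner : ∀ {a x} → (a , x) ∈ zip τ′ u → (a , x) ∈ (m , c) ∷ zip τ′ u ++ (m , b) ∷ []
    inner ax∈ = there (∈-++⁺ˡ ax∈)

    last≡first : b ≡ c
    last≡first =
      Equivalence.to (proj₂ (window-compatible (there (∈-++⁺ʳ (zip τ′ u) (here refl))) (here refl))) refl

    inner-< : ∀ {a x} → (a , x) ∈ zip τ′ u → x < c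
    inner-< ax∈ = Equivalence.to (proj₁ (window-compatible (inner ax∈) (here refl)))
                                 (proj₂ (τ′-letter (proj₁ (∈-zip⁻ τ′ u ax∈))))

    inner-mono : ∀ {a x a′ x′} → (a , x) ∈ zip τ′ u → (a′ , x′) ∈ zip τ′ u → a < a′ → x < x′
    inner-mono ax∈ ax′∈ = Equivalence.to (proj₁ (window-compatible (inner ax∈) (inner ax′∈)))

    inner-functional : ∀ {a x x′} → (a , x) ∈ zip τ′ u → (a , x′) ∈ zip τ′ u → x ≡ x′
    inner-functional ax∈ ax′∈ = Equivalence.to (proj₂ (window-compatible (inner ax∈) (inner ax′∈))) refl

    letters-below : All (_< c) u
    letters-below = All.tabulate λ x∈ → inner-< (proj₂ (∈-zipʳ τ′ u (sym |u|≡L) x∈))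

  startsOccurrence-short : ∀ c w → length w ≤ L → startsOccurrence c w ≡ false
  startsOccurrence-short c w |w|≤L with startsOccurrence c w in starts
  ... | false = refl
  ... | true  = ⊥-elim (ℕ.1+n≰n (begin
    suc (suc L)                              ≡⟨ cong suc length-τ′++m ⟨
    length τ                                 ≡⟨ orderIso⇒length τ _ (Equivalence.from T-≡ starts) ⟩
    length (take (length τ) (c ∷ w))         ≡⟨ List.length-take (length τ) (c ∷ w) ⟩
    length τ ℕ.⊓ suc (length w)              ≤⟨ ℕ.m⊓n≤n (length τ) _ ⟩
    suc (length w)                           ≤⟨ s≤s |w|≤L ⟩
    suc L                                    ∎))
    where open ℕ.≤-Reasoning

  occurrence-starts-at-max : ∀ {x t y} → T (orderIso τ (x ∷ t)) → y ∈ t → y ≤ x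
  occurrence-starts-at-max {x} {t} {y} iso y∈t =
    let a , ay∈ = ∈-zipʳ (τ′ ++ m ∷ []) t (ℕ.suc-injective (orderIso⇒length τ (x ∷ t) iso)) y∈t
        m<a⇔x<y , _ = orderIso⇒Compatible τ (x ∷ t) {m , x} {a , y} iso (here refl) (there ay∈)
    in ℕ.≮⇒≥ λ x<y → ℕ.<⇒≱ (Equivalence.from m<a⇔x<y x<y) (proj₂ (τ-letter (there (proj₁ (∈-zip⁻ _ t ay∈)))))

  occurrences-below : ∀ u {c w} → All (_< c) u → length u ≤ L → occ (u ++ c ∷ w) ≡ occ (c ∷ w)
  occurrences-below []      _           _       = refl
  occurrences-below (x ∷ u) {c} {w} (x<c ∷ u<c) |u|<L =
    cong₂ ℕ._+_ (cong 𝟙 no-occurrence-at-x) (occurrences-below u u<c (ℕ.<⇒≤ |u|<L))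
    where
    no-occurrence-at-x : startsOccurrence x (u ++ c ∷ w) ≡ false
    no-occurrence-at-x with startsOccurrence x (u ++ c ∷ w) in starts
    ... | false = refl
    ... | true  = ⊥-elim (ℕ.<⇒≱ x<c (occurrence-starts-at-max (Equivalence.from T-≡ starts)
                    (∈-take u (subst (length u <_) (sym length-τ′++m) (ℕ.m<n⇒m<1+n |u|<L)))))

  startsOccurrence-window : ∀ c u b w → length u ≡ L → startsOccurrence c (u ++ b ∷ w) ≡ window c u b
  startsOccurrence-window c u b w |u|≡L = cong (λ t → orderIso τ (c ∷ t)) (begin
    take (length (τ′ ++ m ∷ [])) (u ++ b ∷ w)  ≡⟨ cong (λ n → take n (u ++ b ∷ w)) length-τ′++m ⟩
    take (suc L) (u ++ b ∷ w)                  ≡⟨ cong (λ n → take (suc n) (u ++ b ∷ w)) |u|≡L ⟨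
    take (suc (length u)) (u ++ b ∷ w)         ≡⟨ take-prefix u ⟩
    u ++ b ∷ []                                ∎)
    where
    open ≡-Reasoning
    take-prefix : ∀ u → take (suc (length u)) (u ++ b ∷ w) ≡ u ++ b ∷ []
    take-prefix []      = refl
    take-prefix (x ∷ u) = cong (x ∷_) (take-prefix u)

  countFrom : ℕ → ℕ → ℕ → ℕ
  countFrom c n d = ∑[ w ← words k n ] 𝟙 (occ (c ∷ w) ≡ᵇ d)

  count : ℕ → ℕ → ℕ
  count n d = ∑[ w ← words k n ] 𝟙 (occ w ≡ᵇ d)

  leading : ℕ → ℕ → ℕ → ℕ
  leading c n e = ∑[ w ← words k n ] 𝟙 (startsOccurrence c w ∧ (occ w ≡ᵇ e))

  nonleading : ℕ → ℕ → ℕ → ℕ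
  nonleading c n e = ∑[ w ← words k n ] 𝟙 (not (startsOccurrence c w) ∧ (occ w ≡ᵇ e))

  count-split : ∀ c n d → count n d ≡ leading c n d ℕ.+ nonleading c n d
  count-split c n d =
    trans (∑-cong (words k n) λ {w} _ → split (startsOccurrence c w) (occ w ≡ᵇ d)) (∑-+ _ _ (words k n))
    where
    split : ∀ a b → 𝟙 b ≡ 𝟙 (a ∧ b) ℕ.+ 𝟙 (not a ∧ b)
    split true  b = sym (ℕ.+-identityʳ (𝟙 b))
    split false b = refl

  countFrom-zero : ∀ c n → countFrom c n 0 ≡ nonleading c n 0
  countFrom-zero c n = ∑-cong (words k n) λ {w} _ → split (startsOccurrence c w) (occ w)
    where
    split : ∀ a o → 𝟙 (𝟙 a ℕ.+ o ≡ᵇ 0) ≡ 𝟙 (not a ∧ (o ≡ᵇ 0))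
    split true  o = refl
    split false o = refl

  countFrom-suc : ∀ c n d → countFrom c n (suc d) ≡ nonleading c n (suc d) ℕ.+ leading c n d
  countFrom-suc c n d =
    trans (∑-cong (words k n) λ {w} _ → split (startsOccurrence c w) (occ w)) (∑-+ _ _ (words k n))
    where
    split : ∀ a o → 𝟙 (𝟙 a ℕ.+ o ≡ᵇ suc d) ≡ 𝟙 (not a ∧ (o ≡ᵇ suc d)) ℕ.+ 𝟙 (a ∧ (o ≡ᵇ d))
    split true  o = refl
    split false o = sym (ℕ.+-identityʳ _)

  countFrom-short : ∀ c {n} d → n ≤ L → countFrom c n d ≡ count n d
  countFrom-short c {n} d n≤L = ∑-cong (words k n) λ {w} w∈ →
    cong (λ a → 𝟙 (𝟙 a ℕ.+ occ w ≡ᵇ d))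
         (startsOccurrence-short c w (subst (_≤ L) (sym (proj₁ (∈-words⁻ n w∈))) n≤L))

  countFromₛ : ℕ → Series
  countFromₛ c n d = + countFrom c n d

  module FirstLetter (hi : ℕ) (hi<k : hi < k) where

    c : ℕ
    c = suc hi

    nWindows : ℕ
    nWindows = hi C s

    φ : List ℕ → ℕ → ℕ
    φ v a = nth v (ℕ.pred a)

    φ-bounds : ∀ {v} → Increasing s 0 hi v → ∀ {a} → 1 ≤ a → a < m → 0 < φ v a × φ v a ≤ hi
    φ-bounds v↑ (s≤s z≤n) (s≤s i<s) = Increasing-nth v↑ i<s

    φ-mono : ∀ {v} → Increasing s 0 hi v → ∀ {a b} → 1 ≤ a → a < b → b < m → φ v a < φ v b
    φ-mono v↑ (s≤s z≤n) (s≤s i<j) (s≤s j<s) = Increasing-nth-< v↑ i<j j<s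

    φ-window : ∀ {v} → Increasing s 0 hi v → T (window c (map (φ v) τ′) c)
    φ-window {v} v↑ = subst (T ∘ orderIso τ) map-extend (orderIso-map τ extend mono)
      where
      extend : ℕ → ℕ
      extend a with a ℕ.≟ m
      ... | yes _ = c
      ... | no _  = φ v a
      extend-< : ∀ {a} → a < m → extend a ≡ φ v a
      extend-< {a} a<m with a ℕ.≟ m
      ... | yes refl = ⊥-elim (ℕ.<-irrefl refl a<m)
      ... | no _     = refl
      extend-m : extend m ≡ c
      extend-m with m ℕ.≟ m
      ... | yes _   = refl
      ... | no m≢m = ⊥-elim (m≢m refl)
      map-extend : map extend τ ≡ c ∷ map (φ v) τ′ ++ c ∷ []
      map-extend = begin
        extend m ∷ map extend (τ′ ++ m ∷ [])
          ≡⟨ cong (extend m ∷_) (List.map-++ extend τ′ (m ∷ [])) ⟩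
        extend m ∷ map extend τ′ ++ extend m ∷ []
          ≡⟨ cong₂ (λ x xs → x ∷ xs ++ x ∷ []) extend-m
                   (List.map-cong-local (All.tabulate (extend-< ∘ proj₂ ∘ τ′-letter))) ⟩
        c ∷ map (φ v) τ′ ++ c ∷ []
          ∎
        where open ≡-Reasoning
      mono : ∀ {a b} → a ∈ τ → b ∈ τ → a < b → extend a < extend b
      mono a∈ b∈ a<b with τ-letter a∈ | ℕ.m≤n⇒m<n∨m≡n (proj₂ (τ-letter b∈))
      ... | 1≤a , _ | inj₁ b<m =
        subst₂ _<_ (sym (extend-< (ℕ.<-trans a<b b<m))) (sym (extend-< b<m)) (φ-mono v↑ 1≤a a<b b<m)
      ... | 1≤a , _ | inj₂ refl =
        subst₂ _<_ (sym (extend-< a<b)) (sym extend-m) (s≤s (proj₂ (φ-bounds v↑ 1≤a a<b)))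

    module Preimage {u} (u∈ : u ∈ words k L) (iso : T (window c u c)) where

      |u|≡L : length u ≡ L
      |u|≡L = proj₁ (∈-words⁻ L u∈)

      open Window |u|≡L iso

      letterOf : ℕ → ℕ
      letterOf a = partner a (zip τ′ u)

      letterOf-∈ : ∀ {a} → 1 ≤ a → a < m → (a , letterOf a) ∈ zip τ′ u
      letterOf-∈ 1≤a a<m = partner-∈ τ′ u (sym |u|≡L) (τ′-covers 1≤a a<m)

      v̂ : List ℕ
      v̂ = applyUpTo (letterOf ∘ suc) s

      v̂-increasing : Increasing s 0 hi v̂
      v̂-increasing = applyUpTo-Increasing s (letterOf ∘ suc) bounds mono
        where
        bounds : ∀ {i} → i < s → 0 < letterOf (suc i) × letterOf (suc i) ≤ hi
        bounds i<s =
          proj₁ (All.lookup (proj₂ (∈-words⁻ L u∈)) (proj₂ (∈-zip⁻ τ′ u ix∈))) , ℕ.s≤s⁻¹ (inner-< ix∈)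
          where ix∈ = letterOf-∈ (s≤s z≤n) (s≤s i<s)
        mono : ∀ {i j} → i < j → j < s → letterOf (suc i) < letterOf (suc j)
        mono i<j j<s = inner-mono (letterOf-∈ (s≤s z≤n) (s≤s (ℕ.<-trans i<j j<s)))
                                  (letterOf-∈ (s≤s z≤n) (s≤s j<s)) (s≤s i<j)

      u≡φv̂ : u ≡ map (φ v̂) τ′
      u≡φv̂ = sym (map-≡-zip (φ v̂) τ′ u (sym |u|≡L) λ ax∈ →
        let 1≤a , a<m = τ′-letter (proj₁ (∈-zip⁻ τ′ u ax∈)) in
        trans (φ-v̂ 1≤a a<m) (inner-functional (letterOf-∈ 1≤a a<m) ax∈))
        where
        φ-v̂ : ∀ {a} → 1 ≤ a → a < m → φ v̂ a ≡ letterOf a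
        φ-v̂ (s≤s z≤n) (s≤s i<s) = nth-applyUpTo s (letterOf ∘ suc) i<s

      v≡v̂ : ∀ {v} → Increasing s 0 hi v → u ≡ map (φ v) τ′ → v ≡ v̂
      v≡v̂ {v} v↑ u≡φv = begin
        v                             ≡⟨ applyUpTo-nth v ⟨
        applyUpTo (nth v) (length v)  ≡⟨ cong (applyUpTo (nth v)) (Increasing-length v↑) ⟩
        applyUpTo (nth v) s           ≡⟨ applyUpTo-cong-< s (λ i<s →
                                             inner-functional (φ-∈ i<s) (letterOf-∈ (s≤s z≤n) (s≤s i<s))) ⟩
        v̂                             ∎
        where
        open ≡-Reasoning
        φ-∈ : ∀ {i} → i < s → (suc i , nth v i) ∈ zip τ′ u
        φ-∈ i<s = subst ((_ , _) ∈_) (trans (sym (zip-map-self (φ v) τ′)) (cong (zip τ′) (sym u≡φv)))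
                        (∈-map⁺ (λ a → a , φ v a) (τ′-covers (s≤s z≤n) (s≤s i<s)))

    preimages : ∀ {u} → u ∈ words k L →
                ∑[ v ← increasing s 0 hi ] 𝟙 (does (u ≟ᴸ map (φ v) τ′)) ≡ 𝟙 (window c u c)
    preimages {u} u∈ with window c u c in is-window
    ... | true = trans (∑-single (increasing-unique s 0 hi) (∈-increasing⁺ s 0 hi v̂-increasing) not-v̂)
                       (cong 𝟙 (dec-true (u ≟ᴸ map (φ v̂) τ′) u≡φv̂))
      where
      open Preimage u∈ (Equivalence.from T-≡ is-window)
      not-v̂ : ∀ {v} → v ∈ increasing s 0 hi → v ≢ v̂ → 𝟙 (does (u ≟ᴸ map (φ v) τ′)) ≡ 0
      not-v̂ v∈ v≢v̂ = cong 𝟙 (dec-false (u ≟ᴸ _) (v≢v̂ ∘ v≡v̂ (∈-increasing⁻ s 0 hi v∈)))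
    ... | false = ∑-zero (increasing s 0 hi) λ v∈ → cong 𝟙 (dec-false (u ≟ᴸ _) λ u≡φv →
      subst T is-window (subst (λ u → T (window c u c)) (sym u≡φv) (φ-window (∈-increasing⁻ s 0 hi v∈))))

    -- u ↦ v̂ is a bijection from the windows c u c onto the increasing sequences of m - 1 letters below c,
    -- with inverse v ↦ map (φ v) τ′.
    window-count : ∑[ u ← words k L ] 𝟙 (window c u c) ≡ nWindows
    window-count = begin
      ∑[ u ← words k L ] 𝟙 (window c u c)
        ≡⟨ ∑-cong (words k L) preimages ⟨
      ∑[ u ← words k L ] ∑[ v ← increasing s 0 hi ] 𝟙 (does (u ≟ᴸ map (φ v) τ′))
        ≡⟨ ∑-swap (λ u v → 𝟙 (does (u ≟ᴸ map (φ v) τ′))) (words k L) (increasing s 0 hi) ⟩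
      ∑[ v ← increasing s 0 hi ] ∑[ u ← words k L ] 𝟙 (does (u ≟ᴸ map (φ v) τ′))
        ≡⟨ ∑-cong (increasing s 0 hi) (image-once ∘ ∈-increasing⁻ s 0 hi) ⟩
      ∑[ v ← increasing s 0 hi ] 1
        ≡⟨ ∑-1 (increasing s 0 hi) ⟩
      length (increasing s 0 hi)
        ≡⟨ increasing-length s 0 hi ⟩
      nWindows
        ∎
      where
      open ≡-Reasoning
      image-once : ∀ {v} → Increasing s 0 hi v → ∑[ u ← words k L ] 𝟙 (does (u ≟ᴸ map (φ v) τ′)) ≡ 1
      image-once {v} v↑ =
        trans (∑-words-single (map (φ v) τ′) (List.length-map (φ v) τ′) φv-letters
                 (λ u u≢φv → cong 𝟙 (dec-false (u ≟ᴸ _) u≢φv)))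
              (cong 𝟙 (dec-true (map (φ v) τ′ ≟ᴸ map (φ v) τ′) refl))
        where
        φv-letters : All (Letter k) (map (φ v) τ′)
        φv-letters = All.map⁺ (All.tabulate λ a∈ →
          let 1≤a , a<m = τ′-letter a∈ ; 0<φ , φ≤hi = φ-bounds v↑ 1≤a a<m in
          0<φ , ℕ.≤-trans φ≤hi (ℕ.<⇒≤ hi<k))

    leading-count : ∀ r e → leading c (suc (L ℕ.+ r)) e ≡ nWindows ℕ.* countFrom c r e
    leading-count r e = begin
      ∑[ w ← words k (suc (L ℕ.+ r)) ] lead w
        ≡⟨ cong (∑ lead ∘ words k) (ℕ.+-suc L r) ⟨
      ∑[ w ← words k (L ℕ.+ suc r) ] lead w
        ≡⟨ ∑-words-++ k L (suc r) lead ⟩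
      ∑[ u ← words k L ] ∑[ v ← words k (suc r) ] lead (u ++ v)
        ≡⟨ ∑-cong (words k L) (λ {u} _ → ∑-words-suc k r (lead ∘ (u ++_))) ⟩
      ∑[ u ← words k L ] ∑[ b ← letters k ] ∑[ w ← words k r ] lead (u ++ b ∷ w)
        ≡⟨ ∑-cong (words k L) (λ {u} u∈ → ∑-cong (letters k) λ {b} _ →
             trans (∑-cong (words k r) λ {w} _ → window-then-rest {u} {b} {w} (proj₁ (∈-words⁻ L u∈)))
                   (∑-*ˡ (𝟙 (window c u b)) (λ w → 𝟙 (occ (c ∷ w) ≡ᵇ e)) (words k r))) ⟩
      ∑[ u ← words k L ] ∑[ b ← letters k ] (𝟙 (window c u b) ℕ.* countFrom c r e)
        ≡⟨ ∑-cong (words k L) (λ u∈ → ∑-single (letters-unique k) (∈-letters⁺ (s≤s z≤n , hi<k))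
                                                (λ _ → window-closes-with-c (proj₁ (∈-words⁻ L u∈)))) ⟩
      ∑[ u ← words k L ] (𝟙 (window c u c) ℕ.* countFrom c r e)
        ≡⟨ ∑-*ʳ (countFrom c r e) _ (words k L) ⟩
      (∑[ u ← words k L ] 𝟙 (window c u c)) ℕ.* countFrom c r e
        ≡⟨ cong (ℕ._* countFrom c r e) window-count ⟩
      nWindows ℕ.* countFrom c r e
        ∎
      where
      open ≡-Reasoning
      lead : List ℕ → ℕ
      lead w = 𝟙 (startsOccurrence c w ∧ (occ w ≡ᵇ e))
      window-then-rest : ∀ {u b w} → length u ≡ L →
                         lead (u ++ b ∷ w) ≡ 𝟙 (window c u b) ℕ.* 𝟙 (occ (c ∷ w) ≡ᵇ e)
      window-then-rest {u} {b} {w} |u|≡L =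
        trans (cong (λ a → 𝟙 (a ∧ (occ (u ++ b ∷ w) ≡ᵇ e))) (startsOccurrence-window c u b w |u|≡L)) by-window
        where
        by-window : 𝟙 (window c u b ∧ (occ (u ++ b ∷ w) ≡ᵇ e)) ≡ 𝟙 (window c u b) ℕ.* 𝟙 (occ (c ∷ w) ≡ᵇ e)
        by-window with window c u b in is-window
        ... | false = refl
        ... | true  = begin
          𝟙 (occ (u ++ b ∷ w) ≡ᵇ e)  ≡⟨ cong (λ b → 𝟙 (occ (u ++ b ∷ w) ≡ᵇ e)) last≡first ⟩
          𝟙 (occ (u ++ c ∷ w) ≡ᵇ e)  ≡⟨ cong (λ o → 𝟙 (o ≡ᵇ e))
                                            (occurrences-below u letters-below (ℕ.≤-reflexive |u|≡L)) ⟩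
          𝟙 (occ (c ∷ w) ≡ᵇ e)       ≡⟨ ℕ.*-identityˡ _ ⟨
          1 ℕ.* 𝟙 (occ (c ∷ w) ≡ᵇ e) ∎
          where open Window |u|≡L (Equivalence.from T-≡ is-window)
      window-closes-with-c : ∀ {u b} → length u ≡ L → b ≢ c → 𝟙 (window c u b) ℕ.* countFrom c r e ≡ 0
      window-closes-with-c {u} {b} |u|≡L b≢c with window c u b in is-window
      ... | false = refl
      ... | true  = ⊥-elim (b≢c (Window.last≡first |u|≡L (Equivalence.from T-≡ is-window)))

    count-by-leading : ∀ r e →
      nonleading c (suc (L ℕ.+ r)) e ℕ.+ nWindows ℕ.* countFrom c r e ≡ count (suc (L ℕ.+ r)) e
    count-by-leading r e = begin
      nonleading c (suc (L ℕ.+ r)) e ℕ.+ nWindows ℕ.* countFrom c r e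
        ≡⟨ cong (nonleading c (suc (L ℕ.+ r)) e ℕ.+_) (leading-count r e) ⟨
      nonleading c (suc (L ℕ.+ r)) e ℕ.+ leading c (suc (L ℕ.+ r)) e
        ≡⟨ ℕ.+-comm (nonleading c (suc (L ℕ.+ r)) e) (leading c (suc (L ℕ.+ r)) e) ⟩
      leading c (suc (L ℕ.+ r)) e ℕ.+ nonleading c (suc (L ℕ.+ r)) e
        ≡⟨ count-split c (suc (L ℕ.+ r)) e ⟨
      count (suc (L ℕ.+ r)) e
        ∎
      where open ≡-Reasoning

    countFromΔ : Series
    countFromΔ = (oneS ⊖ Y) ⊛ countFromₛ c

    countFromΔ-≡ : ∀ r d → countFromΔ r d ≡ + countFrom c r d - (Y ⊛ countFromₛ c) r d
    countFromΔ-≡ r d = trans (⊛-distribʳ-⊖ oneS Y (countFromₛ c) r d)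
                             (cong (λ z → z - (Y ⊛ countFromₛ c) r d) (⊛-identityˡ (countFromₛ c) r d))

    Recurrence : ℕ → ℕ → Set
    Recurrence n d = + countFrom c n d + + nWindows * ((X ^S suc L) ⊛ countFromΔ) n d ≡ + count n d

    recurrence-short : ∀ {n} d → n ≤ L → Recurrence n d
    recurrence-short {n} d n≤L = begin
      + countFrom c n d + + nWindows * ((X ^S suc L) ⊛ countFromΔ) n d
        ≡⟨ cong (λ z → + countFrom c n d + + nWindows * z) (X^-⊛-< (suc L) countFromΔ d (s≤s n≤L)) ⟩
      + countFrom c n d + + nWindows * + 0
        ≡⟨ cong (λ z → + countFrom c n d + z) (ℤ.*-zeroʳ (+ nWindows)) ⟩
      + countFrom c n d + + 0
        ≡⟨ ℤ.+-identityʳ _ ⟩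
      + countFrom c n d
        ≡⟨ cong +_ (countFrom-short c d n≤L) ⟩
      + count n d
        ∎
      where open ≡-Reasoning

    recurrence-long : ∀ r d →
      + countFrom c (suc (L ℕ.+ r)) d + + nWindows * countFromΔ r d ≡ + count (suc (L ℕ.+ r)) d
    recurrence-long r zero = begin
      + countFrom c (suc (L ℕ.+ r)) 0 + + nWindows * countFromΔ r 0
        ≡⟨ cong₂ (λ a z → + a + + nWindows * z) (countFrom-zero c (suc (L ℕ.+ r)))
                 (trans (countFromΔ-≡ r 0)
                        (trans (cong (λ z → + countFrom c r 0 - z) (Y-⊛-zero (countFromₛ c) r))
                               (ℤ.+-identityʳ _))) ⟩
      + nonleading c (suc (L ℕ.+ r)) 0 + + nWindows * + countFrom c r 0
        ≡⟨ pos-+-* _ _ ⟨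
      + (nonleading c (suc (L ℕ.+ r)) 0 ℕ.+ nWindows ℕ.* countFrom c r 0)
        ≡⟨ cong +_ (count-by-leading r 0) ⟩
      + count (suc (L ℕ.+ r)) 0
        ∎
      where
      open ≡-Reasoning
      pos-+-* : ∀ N a → + (N ℕ.+ nWindows ℕ.* a) ≡ + N + + nWindows * + a
      pos-+-* N a = trans (ℤ.pos-+ N (nWindows ℕ.* a)) (cong (λ z → + N + z) (ℤ.pos-* nWindows a))
    recurrence-long r (suc d) = begin
      + countFrom c (suc (L ℕ.+ r)) (suc d) + + nWindows * countFromΔ r (suc d)
        ≡⟨ cong₂ (λ a z → + a + + nWindows * z)
                 (trans (countFrom-suc c (suc (L ℕ.+ r)) d) (cong (N ℕ.+_) (leading-count r d)))
                 (trans (countFromΔ-≡ r (suc d)) (cong (λ z → + a₁ - z) (Y-⊛-suc (countFromₛ c) r d))) ⟩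
      + (N ℕ.+ nWindows ℕ.* a₀) + + nWindows * (+ a₁ - + a₀)
        ≡⟨ cong (_+ + nWindows * (+ a₁ - + a₀)) (pos-+-* N a₀) ⟩
      + N + + nWindows * + a₀ + + nWindows * (+ a₁ - + a₀)
        ≡⟨ telescope (+ N) (+ nWindows) (+ a₀) (+ a₁) ⟩
      + N + + nWindows * + a₁
        ≡⟨ pos-+-* N a₁ ⟨
      + (N ℕ.+ nWindows ℕ.* a₁)
        ≡⟨ cong +_ (count-by-leading r (suc d)) ⟩
      + count (suc (L ℕ.+ r)) (suc d)
        ∎
      where
      open ≡-Reasoning
      N  = nonleading c (suc (L ℕ.+ r)) (suc d)
      a₀ = countFrom c r d
      a₁ = countFrom c r (suc d)
      pos-+-* : ∀ N a → + (N ℕ.+ nWindows ℕ.* a) ≡ + N + + nWindows * + a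
      pos-+-* N a = trans (ℤ.pos-+ N (nWindows ℕ.* a)) (cong (λ z → + N + z) (ℤ.pos-* nWindows a))
      telescope : ∀ N κ a₀ a₁ → N + κ * a₀ + κ * (a₁ - a₀) ≡ N + κ * a₁
      telescope = solve-∀

    countFrom-recurrence : ∀ n d → Recurrence n d
    countFrom-recurrence n d with n ℕ.≤? L
    ... | yes n≤L = recurrence-short d n≤L
    ... | no n≰L  = subst (λ n → Recurrence n d) (ℕ.m+[n∸m]≡n (ℕ.≰⇒> n≰L))
                          (trans (cong (λ z → + countFrom c (suc L ℕ.+ r) d + + nWindows * z)
                                       (X^-⊛-+ (suc L) countFromΔ r d))
                                 (recurrence-long r d))
      where r = n ∸ suc L

    recurrence : (Dj m (L ℕ.+ 2) hi ⊛ countFromₛ c) ≈S F τ k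
    recurrence n d = begin
      (Dj m (L ℕ.+ 2) hi ⊛ countFromₛ c) n d
        ≡⟨ ⊛-distribʳ-⊕ oneS ((+ nWindows) • ((X ^S (L ℕ.+ 2 ∸ 1)) ⊛ (oneS ⊖ Y))) (countFromₛ c) n d ⟩
      (oneS ⊛ countFromₛ c) n d + (((+ nWindows) • ((X ^S (L ℕ.+ 2 ∸ 1)) ⊛ (oneS ⊖ Y))) ⊛ countFromₛ c) n d
        ≡⟨ cong₂ _+_ (⊛-identityˡ (countFromₛ c) n d)
                     (trans (•-⊛ (+ nWindows) _ (countFromₛ c) n d) (cong (λ z → + nWindows * z) shift)) ⟩
      + countFrom c n d + + nWindows * ((X ^S suc L) ⊛ countFromΔ) n d
        ≡⟨ countFrom-recurrence n d ⟩
      + count n d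
        ≡⟨ cong +_ (countWith-∑ τ d (words k n)) ⟨
      F τ k n d
        ∎
      where
      open ≡-Reasoning
      shift : (((X ^S (L ℕ.+ 2 ∸ 1)) ⊛ (oneS ⊖ Y)) ⊛ countFromₛ c) n d ≡ ((X ^S suc L) ⊛ countFromΔ) n d
      shift = trans (⊛-assoc (X ^S (L ℕ.+ 2 ∸ 1)) (oneS ⊖ Y) (countFromₛ c) n d)
                    (cong (λ a → ((X ^S a) ⊛ countFromΔ) n d) (cong (_∸ 1) (ℕ.+-comm L 2)))

  no-first-letter : ∀ {d} → sumS (upTo k) (λ j → X ⊛ countFromₛ (suc j)) zero d ≡ + 0
  no-first-letter {d} =
    trans (sumS-coefficient (upTo k) (λ j → X ⊛ countFromₛ (suc j)) (λ _ → 0)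
                            (λ j → X-⊛-zero (countFromₛ (suc j)) d))
          (cong +_ (∑-zero (upTo k) (λ _ → refl)))

  F-by-first-letter : F τ k ≈S (oneS ⊕ sumS (upTo k) (λ j → X ⊛ countFromₛ (suc j)))
  F-by-first-letter zero    zero    = sym (cong (λ z → + 1 + z) no-first-letter)
  F-by-first-letter zero    (suc d) = sym (cong (λ z → + 0 + z) no-first-letter)
  F-by-first-letter (suc n) d       = begin
    + countWith τ d (words k (suc n))
      ≡⟨ cong +_ (countWith-∑ τ d (words k (suc n))) ⟩
    + count (suc n) d
      ≡⟨ cong +_ (trans (∑-words-suc k n _) (∑-map _ suc (upTo k))) ⟩
    + ∑[ j ← upTo k ] countFrom (suc j) n d
      ≡⟨ sumS-coefficient (upTo k) (λ j → X ⊛ countFromₛ (suc j)) (λ j → countFrom (suc j) n d)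
                          (λ j → X-⊛-suc (countFromₛ (suc j)) n d) ⟨
    sumS (upTo k) (λ j → X ⊛ countFromₛ (suc j)) (suc n) d
      ≡⟨ ℤ.+-identityˡ _ ⟨
    oneS (suc n) d + sumS (upTo k) (λ j → X ⊛ countFromₛ (suc j)) (suc n) d
      ∎
    where open ≡-Reasoning

  R : List ℕ
  R = range s (k ∸ 1)

  module _ (E : ℕ → Series) (D⊛E≈1 : ∀ j → (Dj m (L ℕ.+ 2) j ⊛ E j) ≈S oneS) (m≤k : m ≤ k) where

    G : ℕ → Series
    G j = X ⊛ countFromₛ (suc j)

    F-fixpoint : F τ k ≈S (oneS ⊕ ((((+ s) • X) ⊕ (X ⊛ sumS R E)) ⊛ F τ k))
    F-fixpoint = begin
      F τ k
        ≈⟨ F-by-first-letter ⟩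
      oneS ⊕ sumS (upTo k) G
        ≡⟨ cong (λ js → oneS ⊕ sumS js G) (upTo-range m≤k) ⟩
      oneS ⊕ sumS (upTo s ++ R) G
        ≈⟨ ⊕-cong {oneS} (≈S-refl {oneS}) (sumS-++ (upTo s) R G) ⟩
      oneS ⊕ (sumS (upTo s) G ⊕ sumS R G)
        ≈⟨ ⊕-cong {oneS} (≈S-refl {oneS}) (⊕-cong {sumS (upTo s) G} low high) ⟩
      oneS ⊕ ((((+ s) • X) ⊛ F τ k) ⊕ ((X ⊛ sumS R E) ⊛ F τ k))
        ≈⟨ ⊕-cong {oneS} (≈S-refl {oneS}) (⊛-distribʳ-⊕ ((+ s) • X) (X ⊛ sumS R E) (F τ k)) ⟨
      oneS ⊕ ((((+ s) • X) ⊕ (X ⊛ sumS R E)) ⊛ F τ k)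
        ∎
      where
      open ≈S-Reasoning
      below-k : ∀ {j} → j ∈ R → j < k
      below-k j∈ = ∈-upTo⁻ (subst (_ ∈_) (sym (upTo-range m≤k)) (∈-++⁺ʳ (upTo s) j∈))
      below-m : ∀ {j} → j < s → countFromₛ (suc j) ≈S F τ k
      below-m {j} j<s = begin
        countFromₛ (suc j)
          ≈⟨ ⊛-identityˡ (countFromₛ (suc j)) ⟨
        oneS ⊛ countFromₛ (suc j)
          ≈⟨ ⊛-cong {Dj m (L ℕ.+ 2) j} {oneS} {countFromₛ (suc j)}
                    (Dj-≈-oneS m (L ℕ.+ 2) j j<s) (≈S-refl {countFromₛ (suc j)}) ⟨
        Dj m (L ℕ.+ 2) j ⊛ countFromₛ (suc j)
          ≈⟨ FirstLetter.recurrence j (ℕ.<-≤-trans (ℕ.m<n⇒m<1+n j<s) m≤k) ⟩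
        F τ k
          ∎
      low : sumS (upTo s) G ≈S (((+ s) • X) ⊛ F τ k)
      low = begin
        sumS (upTo s) G
          ≈⟨ sumS-cong (upTo s) (λ j∈ → ⊛-cong {X} {X} (≈S-refl {X}) (below-m (∈-upTo⁻ j∈))) ⟩
        sumS (upTo s) (λ _ → X ⊛ F τ k)
          ≈⟨ sumS-const (upTo s) (X ⊛ F τ k) ⟩
        (+ length (upTo s)) • (X ⊛ F τ k)
          ≡⟨ cong (λ n → (+ n) • (X ⊛ F τ k)) (List.length-upTo s) ⟩
        (+ s) • (X ⊛ F τ k)
          ≈⟨ •-⊛ (+ s) X (F τ k) ⟨
        ((+ s) • X) ⊛ F τ k
          ∎
      high : sumS R G ≈S ((X ⊛ sumS R E) ⊛ F τ k)
      high = begin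
        sumS R G
          ≈⟨ sumS-cong R {G} {λ j → X ⊛ (E j ⊛ F τ k)} (λ {j} j∈ → ⊛-cong {X} {X} (≈S-refl {X})
               (⊛-solve {Dj m (L ℕ.+ 2) j} {E j} {countFromₛ (suc j)}
                        (D⊛E≈1 j) (FirstLetter.recurrence j (below-k j∈)))) ⟩
        sumS R (λ j → X ⊛ (E j ⊛ F τ k))
          ≈⟨ ⊛-sumS X R (λ j → E j ⊛ F τ k) ⟨
        X ⊛ sumS R (λ j → E j ⊛ F τ k)
          ≈⟨ ⊛-cong {X} {X} (≈S-refl {X}) (sumS-⊛ R E (F τ k)) ⟨
        X ⊛ (sumS R E ⊛ F τ k)
          ≈⟨ ⊛-assoc X (sumS R E) (F τ k) ⟨
        (X ⊛ sumS R E) ⊛ F τ k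
          ∎

-- Integer arithmetic is opened only inside PowerSeries and Pattern, so that _+_ below is addition on ℕ.
open import Data.Nat using (_+_)

theorem2p7 : (m k : ℕ) → 1 ≤ m → m ≤ k → (τ' : List ℕ) →
    All (λ a → 1 ≤ a × a ≤ m) τ' → m ∉ τ' →
    (∀ a → 1 ≤ a → a ≤ m → a ∈ (m ∷ τ' ++ m ∷ [])) →
    (E : ℕ → Series) →
    (∀ j → (Dj m (length τ' + 2) j ⊛ E j) ≈S oneS) →
    (denominator m k E ⊛ F (m ∷ τ' ++ m ∷ []) k) ≈S oneS
theorem2p7 (suc s) k _ m≤k τ′ τ′-letters m∉τ′ covers E D⊛E≈1 = begin
  denominator (suc s) k E ⊛ F τ k
    ≈⟨ ⊛-cong {denominator (suc s) k E} {oneS ⊖ U} {F τ k} {F τ k}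
              (⊖-⊖ oneS ((+ s) • X) (X ⊛ sumS R E)) (≈S-refl {F τ k}) ⟩
  (oneS ⊖ U) ⊛ F τ k
    ≈⟨ fixpoint⇒inverse {U} {F τ k} (F-fixpoint E D⊛E≈1 m≤k) ⟩
  oneS
    ∎
  where
  open Pattern k s τ′ τ′-letters m∉τ′ covers
  open ≈S-Reasoning
  U : Series
  U = ((+ s) • X) ⊕ (X ⊛ sumS R E)
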